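{- For every $n\geqslant 0$, $$\sum_{\pi\in\mathfrak{S}_{n+1}}x^{{\rm basc}(\pi)}y^{{\rm des}(\pi)}(-y)^{{\rm suc}(\pi)}=\sum_{j=0}^{\lfloor n/2\rfloor}\gamma_{n,0,j}(2xy)^j(x+y)^{n-2j},$$ and consequently $$\sum_{i=0}^n\binom{n}{i}d_i(x)d_{n-i}(x)=\sum_{j=0}^{\lfloor n/2\rfloor}\gamma_{n,0,j}(2x)^j(1+x)^{n-2j},$$ so the binomial convolution of derangement polynomials is $\gamma$-positive.
   Context: For $\pi\in\mathfrak{S}_n$: ${\rm des}(\pi)=\#\{i\in[n-1]:\pi(i)>\pi(i+1)\}$, ${\rm suc}(\pi)=\#\{i\in[n-1]:\pi(i+1)=\pi(i)+1\}$, ${\rm basc}(\pi)=\#\{i\in[n-1]:\pi(i+1)\geqslant\pi(i)+2\}$, ${\rm exc}(\pi)=\#\{i:\pi(i)>i\}$. $d_n(x)=\sum x^{{\rm exc}(\pi)}$ over derangements (fixed-point-free) $\pi\in\mathfrak{S}_n$, $d_0(x)=1$. The integers $\gamma_{n,i,j}$ are defined by $\gamma_{0,0,0}=1$, $\gamma_{0,i,j}=0$ for $(i,j)\neq(0,0)$, $\gamma_{n,i,j}=0$ if an index is negative, and $\gamma_{n+1,i,j}=\gamma_{n,i-1,j}+(1+i)\gamma_{n,i+1,j-1}+j\gamma_{n,i,j}+(n-i-2j+2)\gamma_{n,i,j-1}$; equivalently $\gamma_{n,0,j}$ is the number of 0-1-2 increasing planted trees on $\{0,\dots,n\}$ (rooted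 at $0$, labels increasing from the root, non-root vertices with at most two children, children of the root with at most one child) having $j$ leaves, none of them a child of the root. -}

module Defs where

open import Data.Nat as ℕ using (ℕ; zero; suc)
open import Data.Nat.Combinatorics using (_C_)
open import Data.Nat.DivMod using (_/_)
open import Data.Bool using (Bool; true; false; _∧_; if_then_else_; not)
open import Data.List using (List; []; _∷_; map; concatMap; filter; upTo; foldr; length)
open import Data.Integer as ℤ using (ℤ; +_; _+_; _*_; _-_; -_; _^_)
open import Relation.Nullary.Decidable using (⌊_⌋)
open import Relation.Unary using (Decidable)
open import Data.List.Relation.Unary.All using (All)

Σ[_]_ : {A : Set} → List A → (A → ℤ) → ℤ
Σ[ xs ] f = foldr (λ a acc → f a + acc) (+ 0) xs

words : ℕ → ℕ → List (List ℕ)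
words zero    k = [] ∷ []
words (suc n) k = concatMap (λ a → map (a ∷_) (words n k)) (upTo k)

elem : ℕ → List ℕ → Bool
elem a []       = false
elem a (b ∷ bs) = if ⌊ a ℕ.≟ b ⌋ then true else elem a bs

distinct : List ℕ → Bool
distinct []       = true
distinct (a ∷ as) = not (elem a as) ∧ distinct as

-- The symmetric group 𝔖_n: all bijections {0..n-1} → {0..n-1}, in one-line
-- notation (the list [π(0), …, π(n-1)]), i.e. all length-n words over
-- {0..n-1} with pairwise distinct letters.  (Values and positions are
-- shifted by 1 relative to the paper's [n]; all statistics are invariant.)
Perm : ℕ → List (List ℕ)
Perm n = filter (λ w → Data.Bool._≟_ (distinct w) true) (words n n)
  where import Data.Bool

countAdj : (ℕ → ℕ → Bool) → List ℕ → ℕ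
countAdj p []           = 0
countAdj p (a ∷ [])     = 0
countAdj p (a ∷ b ∷ bs) = (if p a b then 1 else 0) ℕ.+ countAdj p (b ∷ bs)

des : List ℕ → ℕ
des = countAdj (λ a b → ⌊ b ℕ.<? a ⌋)

sucs : List ℕ → ℕ
sucs = countAdj (λ a b → ⌊ b ℕ.≟ suc a ⌋)

basc : List ℕ → ℕ
basc = countAdj (λ a b → ⌊ suc (suc a) ℕ.≤? b ⌋)

countPos : (ℕ → ℕ → Bool) → ℕ → List ℕ → ℕ
countPos p i []       = 0
countPos p i (a ∷ as) = (if p i a then 1 else 0) ℕ.+ countPos p (suc i) as

exc : List ℕ → ℕ
exc = countPos (λ i a → ⌊ i ℕ.<? a ⌋) 0

fix : List ℕ → ℕ
fix = countPos (λ i a → ⌊ i ℕ.≟ a ⌋) 0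

Der : ℕ → List (List ℕ)
Der n = filter (λ w → fix w ℕ.≟ 0) (Perm n)

d : ℕ → ℤ → ℤ
d n x = Σ[ Der n ] (λ π → x ^ exc π)

-- γ_{n,i,j} via the recurrence
-- γ_{n+1,i,j} = γ_{n,i-1,j} + (1+i) γ_{n,i+1,j-1} + j γ_{n,i,j} + (n-i-2j+2) γ_{n,i,j-1},
-- terms with a negative index being 0.
γ : ℕ → ℕ → ℕ → ℤ
γ zero    zero    zero    = + 1
γ zero    _       _       = + 0
γ (suc n) i j = t₁ i j + t₂ i j + (+ j) * γ n i j + t₄ i j
  where
  t₁ : ℕ → ℕ → ℤ
  t₁ zero     j = + 0
  t₁ (suc i') j = γ n i' j
  t₂ : ℕ → ℕ → ℤ
  t₂ i zero     = + 0
  t₂ i (suc j') = (+ suc i) * γ n (suc i) j'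
  t₄ : ℕ → ℕ → ℤ
  t₄ i zero     = + 0
  t₄ i (suc j') = ((+ n) - (+ i) - (+ (2 ℕ.* suc j')) + (+ 2)) * γ n i j'

LHS₁ : ℕ → ℤ → ℤ → ℤ
LHS₁ n x y = Σ[ Perm (suc n) ] (λ π → x ^ basc π * y ^ des π * (- y) ^ sucs π)

RHS₁ : ℕ → ℤ → ℤ → ℤ
RHS₁ n x y = Σ[ upTo (suc (n / 2)) ] (λ j → γ n 0 j * ((+ 2) * x * y) ^ j * (x + y) ^ (n ℕ.∸ 2 ℕ.* j))

LHS₂ : ℕ → ℤ → ℤ
LHS₂ n x = Σ[ upTo (suc n) ] (λ i → (+ (n C i)) * d i x * d (n ℕ.∸ i) x)

RHS₂ : ℕ → ℤ → ℤ
RHS₂ n x = Σ[ upTo (suc (n / 2)) ] (λ j → γ n 0 j * ((+ 2) * x) ^ j * ((+ 1) + x) ^ (n ℕ.∸ 2 ℕ.* j))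

{-# OPTIONS --safe #-}
module Submission where

-- Every sum in the theorem is a specialisation of a sequence f n of polynomials in X, Y, Z with
-- f (n + 1) = c · f n + XY · ∂ (f n), where ∂ = ∂/∂X + ∂/∂Y + ∂/∂Z; such a sequence is determined
-- by c and f 0.
--
-- Inserting the letter n + 1 into every slot of a permutation of {0, …, n} shows that
-- P n = ∑_{π ∈ 𝔖_{n+1}} X^basc Y^des Z^suc obeys this recurrence with c = Y + Z: the slot after n
-- creates a succession, the first slot a descent, and every other slot turns one adjacency into a
-- big ascent followed by a descent (or appends a big ascent). The recurrence for γ gives the same
-- recurrence for Q n = ∑ γ_{n,i,j} (2XY)^j (X + Y)^(n−i−2j) (Y + Z)^i, so P = Q, and Z = −Y kills
-- every term with i > 0.
--
-- Inserting n into a cycle of a permutation of {0, …, n − 1}, or adding it as a fixed point, shows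
-- that F n = ∑_{π ∈ 𝔖_n} X^exc Y^drop Z^fix obeys the recurrence with c = Z. By the Leibniz rule the
-- binomial convolution F ⋆ F then obeys it with c = 2Z, and so does P n (X, Y, 2Z − Y). At
-- (x, 1, 0), F n is the derangement polynomial d n, and P n (x, 1, −1) is the left side of the first
-- identity at y = 1.

open import Defs

open import Level using (0ℓ)
open import Algebra.Bundles using (CommutativeRing)
open import Algebra.Structures using (IsCommutativeRing)
open import Algebra.Solver.Ring.AlmostCommutativeRing
  using (fromCommutativeRing; _-Raw-AlmostCommutative⟶_)
open import Data.Bool as Bool using (true; false; if_then_else_)
open import Data.Empty using (⊥-elim)
open import Data.Integer as ℤ using (ℤ; +_)
import Data.Integer.Properties as ℤP
import Data.Integer.Tactic.RingSolver as ℤ-Solver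
open import Data.List
  using ( List; []; _∷_; _++_; [_]; length; map; foldr; filter; concatMap; applyUpTo; upTo
        ; cartesianProduct; cartesianProductWith)
open import Data.List.Properties using (length-++)
open import Data.List.Membership.Propositional using (_∈_; _∉_)
open import Data.List.Membership.Propositional.Properties
  using ( ∈-cartesianProductWith⁺; ∈-cartesianProductWith⁻; ∈-upTo⁺; ∈-upTo⁻; ∈-filter⁺; ∈-filter⁻
        ; ∈-∃++; ∈-map⁺; ∈-map⁻; ∈-++⁻)
open import Data.List.Membership.Propositional.Properties.WithK using (unique∧set⇒bag)
open import Data.List.Relation.Binary.BagAndSetEquality using (∼bag⇒↭)
open import Data.List.Relation.Binary.Permutation.Propositional as ↭ using (_↭_; ↭⇒↭ₛ)
import Data.List.Relation.Binary.Permutation.Propositional.Properties as ↭ₚ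
open import Data.List.Relation.Unary.All as All using (All; []; _∷_)
import Data.List.Relation.Unary.All.Properties as Allₚ
open Allₚ using (¬Any⇒All¬; All¬⇒¬Any)
open import Data.List.Relation.Unary.AllPairs as AllPairs using ([]; _∷_)
open import Data.List.Relation.Unary.Any using (here; there; any?)
open import Data.List.Relation.Unary.Unique.Propositional using (Unique)
import Data.List.Relation.Unary.Unique.Propositional.Properties as Uniqueₚ
import Data.Maybe as Maybe
open import Data.Nat as ℕ using (ℕ; zero; suc; _≤_; _<_; _∸_; z≤n; s≤s)
open import Data.Nat.Combinatorics using (_C_; nCk+nC[k+1]≡[n+1]C[k+1]; k>n⇒nCk≡0)
open import Data.Nat.DivMod using (_/_; _%_; m≡m%n+[m/n]*n; m%n<n; m/n≤m)
import Data.Nat.Properties as ℕP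
import Data.Nat.Tactic.RingSolver as ℕ-Solver
open import Data.Product using (_×_; _,_; proj₁; proj₂; uncurry; swap)
open import Data.Sum using (_⊎_; inj₁; inj₂)
open import Function using (_∘_; case_of_)
open import Function.Bundles using (mk⇔)
open import Relation.Binary.PropositionalEquality hiding ([_])
import Data.List.Relation.Binary.Permutation.Setoid.Properties (setoid ℕ) as ↭ₛ
open import Relation.Nullary using (¬_; yes; no; does)
open import Relation.Nullary.Decidable using (⌊_⌋)
open import Relation.Nullary.Decidable.Core using (dec⇒maybe)
open import Relation.Unary using (Decidable)

-- Commutative rings with propositional equality, axiomatised minimally so that the dual numbers are
-- easy to build; ι is the ring map from ℤ, needed for integer coefficients and by the ring solver.
record CommRing : Set₁ where
  infixl 6 _+_
  infixl 7 _*_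
  infix  8 -_
  field
    Carrier     : Set
    _+_ _*_     : Carrier → Carrier → Carrier
    -_          : Carrier → Carrier
    ι           : ℤ → Carrier
    +-assoc     : ∀ a b c → (a + b) + c ≡ a + (b + c)
    +-comm      : ∀ a b → a + b ≡ b + a
    +-identityˡ : ∀ a → ι (+ 0) + a ≡ a
    -‿inverseˡ  : ∀ a → (- a) + a ≡ ι (+ 0)
    *-assoc     : ∀ a b c → (a * b) * c ≡ a * (b * c)
    *-comm      : ∀ a b → a * b ≡ b * a
    *-identityˡ : ∀ a → ι (+ 1) * a ≡ a
    distribʳ    : ∀ a b c → (a + b) * c ≡ a * c + b * c
    ι-+         : ∀ a b → ι (a ℤ.+ b) ≡ ι a + ι b
    ι-*         : ∀ a b → ι (a ℤ.* b) ≡ ι a * ι b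

  0# 1# : Carrier
  0# = ι (+ 0)
  1# = ι (+ 1)

  nat : ℕ → Carrier
  nat k = ι (+ k)

  infixr 8 _^_
  _^_ : Carrier → ℕ → Carrier
  x ^ zero  = 1#
  x ^ suc k = x * x ^ k

module CommRingProperties (R : CommRing) where
  open CommRing R

  isCommutativeRing : IsCommutativeRing _≡_ _+_ _*_ -_ 0# 1#
  isCommutativeRing = record
    { isRing = record
      { +-isAbelianGroup = record
        { isGroup = record
          { isMonoid = record
            { isSemigroup = record
              { isMagma = record { isEquivalence = isEquivalence ; ∙-cong = cong₂ _+_ }
              ; assoc = +-assoc }
            ; identity = +-identityˡ , λ a → trans (+-comm a 0#) (+-identityˡ a) }
          ; inverse = -‿inverseˡ , λ a → trans (+-comm a (- a)) (-‿inverseˡ a)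
          ; ⁻¹-cong = cong -_ }
        ; comm = +-comm }
      ; *-cong = cong₂ _*_
      ; *-assoc = *-assoc
      ; *-identity = *-identityˡ , λ a → trans (*-comm a 1#) (*-identityˡ a)
      ; distrib = (λ a b c → trans (*-comm a (b + c))
                              (trans (distribʳ b c a) (cong₂ _+_ (*-comm b a) (*-comm c a))))
                , (λ a b c → distribʳ b c a) }
    ; *-comm = *-comm }

  commutativeRing : CommutativeRing 0ℓ 0ℓ
  commutativeRing = record { isCommutativeRing = isCommutativeRing }

  open CommutativeRing commutativeRing public using (zeroˡ; zeroʳ; distribˡ; +-identityʳ)

  ι-neg : ∀ a → ι (ℤ.- a) ≡ - ι a
  ι-neg a = begin
    ι (ℤ.- a)                  ≡⟨ sym (+-identityˡ _) ⟩
    0# + ι (ℤ.- a)             ≡⟨ cong (_+ ι (ℤ.- a)) (sym (-‿inverseˡ (ι a))) ⟩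
    (- ι a + ι a) + ι (ℤ.- a)  ≡⟨ +-assoc _ _ _ ⟩
    - ι a + (ι a + ι (ℤ.- a))  ≡⟨ cong (λ t → - ι a + t) (ι-+ a (ℤ.- a)) ⟨
    - ι a + ι (a ℤ.+ ℤ.- a)    ≡⟨ cong (λ t → - ι a + ι t) (ℤP.+-inverseʳ a) ⟩
    - ι a + 0#                 ≡⟨ +-identityʳ _ ⟩
    - ι a                      ∎
    where open ≡-Reasoning

  ι-homomorphism : CommutativeRing.rawRing ℤP.+-*-commutativeRing
                     -Raw-AlmostCommutative⟶ fromCommutativeRing commutativeRing
  ι-homomorphism = record
    { ⟦_⟧ = ι ; +-homo = ι-+ ; *-homo = ι-* ; -‿homo = ι-neg ; 0-homo = refl ; 1-homo = refl }

  open import Algebra.Solver.Ring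
    (CommutativeRing.rawRing ℤP.+-*-commutativeRing) (fromCommutativeRing commutativeRing)
    ι-homomorphism (λ a b → Maybe.map (cong ι) (dec⇒maybe (a ℤ.≟ b))) public

ℤ-ring : CommRing
ℤ-ring = record
  { Carrier = ℤ ; _+_ = ℤ._+_ ; _*_ = ℤ._*_ ; -_ = ℤ.-_ ; ι = λ z → z
  ; +-assoc = ℤP.+-assoc ; +-comm = ℤP.+-comm ; +-identityˡ = ℤP.+-identityˡ
  ; -‿inverseˡ = ℤP.+-inverseˡ ; *-assoc = ℤP.*-assoc ; *-comm = ℤP.*-comm
  ; *-identityˡ = ℤP.*-identityˡ ; distribʳ = λ a b c → ℤP.*-distribʳ-+ c a b
  ; ι-+ = λ _ _ → refl ; ι-* = λ _ _ → refl }

module Sums (R : CommRing) where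
  open CommRing R
  open CommRingProperties R

  ∑< : ℕ → (ℕ → Carrier) → Carrier
  ∑< zero    f = 0#
  ∑< (suc K) f = f 0 + ∑< K (f ∘ suc)

  ∑<-cong : ∀ K {f g} → (∀ i → i < K → f i ≡ g i) → ∑< K f ≡ ∑< K g
  ∑<-cong zero    eq = refl
  ∑<-cong (suc K) eq = cong₂ _+_ (eq 0 (s≤s z≤n)) (∑<-cong K (λ i i<K → eq (suc i) (s≤s i<K)))

  ∑<-zero : ∀ K f → (∀ i → i < K → f i ≡ 0#) → ∑< K f ≡ 0#
  ∑<-zero K f eq = trans (∑<-cong K eq) (zero-sum K)
    where
    zero-sum : ∀ K → ∑< K (λ _ → 0#) ≡ 0#
    zero-sum zero    = refl
    zero-sum (suc K) = trans (cong (_+_ 0#) (zero-sum K)) (+-identityˡ 0#)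

  ∑<-+ : ∀ K f g → ∑< K (λ i → f i + g i) ≡ ∑< K f + ∑< K g
  ∑<-+ zero    f g = sym (+-identityˡ 0#)
  ∑<-+ (suc K) f g = trans (cong (_+_ (f 0 + g 0)) (∑<-+ K (f ∘ suc) (g ∘ suc)))
    (solve 4 (λ a b c d → (a :+ b) :+ (c :+ d) := (a :+ c) :+ (b :+ d)) refl (f 0) (g 0) _ _)

  ∑<-*ˡ : ∀ K c f → ∑< K (λ i → c * f i) ≡ c * ∑< K f
  ∑<-*ˡ zero    c f = sym (zeroʳ c)
  ∑<-*ˡ (suc K) c f = trans (cong (_+_ (c * f 0)) (∑<-*ˡ K c (f ∘ suc))) (sym (distribˡ c _ _))

  ∑<-vanishing-tail : ∀ {K L} f → K ≤ L → (∀ i → K ≤ i → f i ≡ 0#) → ∑< L f ≡ ∑< K f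
  ∑<-vanishing-tail {zero}  {L}     f _         eq = ∑<-zero L f (λ i _ → eq i z≤n)
  ∑<-vanishing-tail {suc K} {suc L} f (s≤s K≤L) eq =
    cong (_+_ (f 0)) (∑<-vanishing-tail (f ∘ suc) K≤L (λ i K≤i → eq (suc i) (s≤s K≤i)))

  ∑<-head-zero : ∀ K f → f 0 ≡ 0# → ∑< (suc K) f ≡ ∑< K (f ∘ suc)
  ∑<-head-zero K f f₀≡0 = trans (cong (_+ ∑< K (f ∘ suc)) f₀≡0) (+-identityˡ _)

  ∑<-suc : ∀ K f → ∑< (suc K) f ≡ ∑< K f + f K
  ∑<-suc zero    f = +-comm (f 0) 0#
  ∑<-suc (suc K) f = trans (cong (_+_ (f 0)) (∑<-suc K (f ∘ suc))) (sym (+-assoc _ _ _))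

  ∑ : {A : Set} → List A → (A → Carrier) → Carrier
  ∑ xs f = foldr (λ a s → f a + s) 0# xs

  ∑-cong : {A : Set} (xs : List A) {f g : A → Carrier} → (∀ x → x ∈ xs → f x ≡ g x) → ∑ xs f ≡ ∑ xs g
  ∑-cong []       eq = refl
  ∑-cong (x ∷ xs) eq = cong₂ _+_ (eq x (here refl)) (∑-cong xs (λ y y∈xs → eq y (there y∈xs)))

  ∑-+ : {A : Set} (xs : List A) (f g : A → Carrier) → ∑ xs (λ a → f a + g a) ≡ ∑ xs f + ∑ xs g
  ∑-+ []       f g = sym (+-identityˡ 0#)
  ∑-+ (x ∷ xs) f g = trans (cong (_+_ (f x + g x)) (∑-+ xs f g))
    (solve 4 (λ a b c d → (a :+ b) :+ (c :+ d) := (a :+ c) :+ (b :+ d)) refl (f x) (g x) _ _)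

  ∑-*ˡ : {A : Set} (xs : List A) (c : Carrier) (f : A → Carrier) → ∑ xs (λ a → c * f a) ≡ c * ∑ xs f
  ∑-*ˡ []       c f = sym (zeroʳ c)
  ∑-*ˡ (x ∷ xs) c f = trans (cong (_+_ (c * f x)) (∑-*ˡ xs c f)) (sym (distribˡ c _ _))

  ∑-↭ : {A : Set} {xs ys : List A} (f : A → Carrier) → xs ↭ ys → ∑ xs f ≡ ∑ ys f
  ∑-↭ f ↭.refl          = refl
  ∑-↭ f (↭.prep x p)    = cong (_+_ (f x)) (∑-↭ f p)
  ∑-↭ f (↭.swap x y p)  = trans (sym (+-assoc (f x) (f y) _))
    (trans (cong₂ _+_ (+-comm (f x) (f y)) (∑-↭ f p)) (+-assoc (f y) (f x) _))
  ∑-↭ f (↭.trans p q)   = trans (∑-↭ f p) (∑-↭ f q)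

  ∑-++ : {A : Set} (xs ys : List A) (f : A → Carrier) → ∑ (xs ++ ys) f ≡ ∑ xs f + ∑ ys f
  ∑-++ []       ys f = sym (+-identityˡ _)
  ∑-++ (x ∷ xs) ys f = trans (cong (_+_ (f x)) (∑-++ xs ys f)) (sym (+-assoc _ _ _))

  ∑-map : {A B : Set} (g : A → B) (xs : List A) (f : B → Carrier) → ∑ (map g xs) f ≡ ∑ xs (f ∘ g)
  ∑-map g []       f = refl
  ∑-map g (x ∷ xs) f = cong (_+_ (f (g x))) (∑-map g xs f)

  ∑-cartesianProduct : {A B : Set} (xs : List A) (ys : List B) (f : A × B → Carrier) →
                       ∑ (cartesianProduct xs ys) f ≡ ∑ xs (λ a → ∑ ys (λ b → f (a , b)))
  ∑-cartesianProduct []       ys f = refl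
  ∑-cartesianProduct (x ∷ xs) ys f =
    trans (∑-++ (map (x ,_) ys) _ f) (cong₂ _+_ (∑-map (x ,_) ys f) (∑-cartesianProduct xs ys f))

  ∑-filter : {A : Set} {P : A → Set} (P? : Decidable P) (xs : List A) (f : A → Carrier) →
             ∑ (filter P? xs) f ≡ ∑ xs (λ x → if does (P? x) then f x else 0#)
  ∑-filter P? []       f = refl
  ∑-filter P? (x ∷ xs) f with does (P? x)
  ... | true  = cong (_+_ (f x)) (∑-filter P? xs f)
  ... | false = trans (∑-filter P? xs f) (sym (+-identityˡ _))

  ∑-applyUpTo : ∀ K (g : ℕ → ℕ) (f : ℕ → Carrier) → ∑ (applyUpTo g K) f ≡ ∑< K (f ∘ g)
  ∑-applyUpTo zero    g f = refl
  ∑-applyUpTo (suc K) g f = cong (_+_ (f (g 0))) (∑-applyUpTo K (g ∘ suc) f)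

  ∑-upTo : ∀ K (f : ℕ → Carrier) → ∑ (upTo K) f ≡ ∑< K f
  ∑-upTo K = ∑-applyUpTo K (λ i → i)

  ∑² : ℕ → (ℕ → ℕ → Carrier) → Carrier
  ∑² K f = ∑< K (λ i → ∑< K (f i))

  ∑²-cong : ∀ K {f g} → (∀ i j → f i j ≡ g i j) → ∑² K f ≡ ∑² K g
  ∑²-cong K eq = ∑<-cong K (λ i _ → ∑<-cong K (λ j _ → eq i j))

  ∑²-+ : ∀ K f g → ∑² K (λ i j → f i j + g i j) ≡ ∑² K f + ∑² K g
  ∑²-+ K f g = trans (∑<-cong K (λ i _ → ∑<-+ K (f i) (g i))) (∑<-+ K _ _)

  ∑²-*ˡ : ∀ K c f → ∑² K (λ i j → c * f i j) ≡ c * ∑² K f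
  ∑²-*ˡ K c f = trans (∑<-cong K (λ i _ → ∑<-*ˡ K c (f i))) (∑<-*ˡ K c _)

-- Dual numbers and the derivation ∂

Dual : CommRing → CommRing
Dual R = record
  { Carrier     = Carrier × Carrier
  ; _+_         = λ { (a , a′) (b , b′) → a + b , a′ + b′ }
  ; _*_         = λ { (a , a′) (b , b′) → a * b , a * b′ + a′ * b }
  ; -_          = λ { (a , a′) → - a , - a′ }
  ; ι           = λ z → ι z , 0#
  ; +-assoc     = λ { (a , a′) (b , b′) (c , c′) → cong₂ _,_ (+-assoc a b c) (+-assoc a′ b′ c′) }
  ; +-comm      = λ { (a , a′) (b , b′) → cong₂ _,_ (+-comm a b) (+-comm a′ b′) }
  ; +-identityˡ = λ { (a , a′) → cong₂ _,_ (+-identityˡ a) (+-identityˡ a′) }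
  ; -‿inverseˡ  = λ { (a , a′) → cong₂ _,_ (-‿inverseˡ a) (-‿inverseˡ a′) }
  ; *-assoc     = λ { (a , a′) (b , b′) (c , c′) → cong₂ _,_ (*-assoc a b c)
      (solve 6 (λ a a′ b b′ c c′ → (a :* b) :* c′ :+ (a :* b′ :+ a′ :* b) :* c
                                   := a :* (b :* c′ :+ b′ :* c) :+ a′ :* (b :* c))
             refl a a′ b b′ c c′) }
  ; *-comm      = λ { (a , a′) (b , b′) → cong₂ _,_ (*-comm a b)
      (solve 4 (λ a a′ b b′ → a :* b′ :+ a′ :* b := b :* a′ :+ b′ :* a) refl a a′ b b′) }
  ; *-identityˡ = λ { (a , a′) → cong₂ _,_ (*-identityˡ a)
      (solve 2 (λ a a′ → con (+ 1) :* a′ :+ con (+ 0) :* a := a′) refl a a′) }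
  ; distribʳ    = λ { (a , a′) (b , b′) (c , c′) → cong₂ _,_ (distribʳ a b c)
      (solve 6 (λ a a′ b b′ c c′ → (a :+ b) :* c′ :+ (a′ :+ b′) :* c
                                   := (a :* c′ :+ a′ :* c) :+ (b :* c′ :+ b′ :* c))
             refl a a′ b b′ c c′) }
  ; ι-+         = λ a b → cong₂ _,_ (ι-+ a b) (sym (+-identityˡ 0#))
  ; ι-*         = λ a b → cong₂ _,_ (ι-* a b)
      (solve 2 (λ a b → con (+ 0) := a :* con (+ 0) :+ con (+ 0) :* b) refl (ι a) (ι b)) }
  where open CommRing R; open CommRingProperties R

_+ε : {R : CommRing} → CommRing.Carrier R → CommRing.Carrier (Dual R)
_+ε {R} a = a , CommRing.1# R

-- A ring-polymorphic function of three variables stands for a polynomial in ℤ[X, Y, Z];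
-- ∂ f = (∂/∂X + ∂/∂Y + ∂/∂Z) f is the ε-part of f (X + ε, Y + ε, Z + ε).
Poly₃ : Set₁
Poly₃ = (R : CommRing) → let C = CommRing.Carrier R in C → C → C → C

∂ : Poly₃ → Poly₃
∂ f R X Y Z = proj₂ (f (Dual R) (_+ε {R} X) (_+ε {R} Y) (_+ε {R} Z))

Recurrence : Poly₃ → (ℕ → Poly₃) → Set₁
Recurrence c f = ∀ n R X Y Z → let open CommRing R in
  f (suc n) R X Y Z ≡ c R X Y Z * f n R X Y Z + X * Y * ∂ (f n) R X Y Z

-- The induction hypothesis is used over the dual numbers, hence over all rings at once.
recurrence-determined : ∀ {c} f g → Recurrence c f → Recurrence c g →
                        (∀ R X Y Z → f 0 R X Y Z ≡ g 0 R X Y Z) →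
                        ∀ n R X Y Z → f n R X Y Z ≡ g n R X Y Z
recurrence-determined f g rec-f rec-g f₀≡g₀ zero    R X Y Z = f₀≡g₀ R X Y Z
recurrence-determined {c} f g rec-f rec-g f₀≡g₀ (suc n) R X Y Z = begin
  f (suc n) R X Y Z                                   ≡⟨ rec-f n R X Y Z ⟩
  c R X Y Z * f n R X Y Z + X * Y * ∂ (f n) R X Y Z   ≡⟨ cong₂ (λ a b → c R X Y Z * a + X * Y * b)
                                                          (fₙ≡gₙ R X Y Z) (cong proj₂ (fₙ≡gₙ (Dual R) _ _ _)) ⟩
  c R X Y Z * g n R X Y Z + X * Y * ∂ (g n) R X Y Z   ≡⟨ rec-g n R X Y Z ⟨
  g (suc n) R X Y Z                                   ∎
  where
  open CommRing R
  open ≡-Reasoning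
  fₙ≡gₙ : ∀ R X Y Z → f n R X Y Z ≡ g n R X Y Z
  fₙ≡gₙ = recurrence-determined f g rec-f rec-g f₀≡g₀ n

module DualProperties (R : CommRing) where
  open CommRing R
  open CommRingProperties R
  open Sums R
  private
    module D = CommRing (Dual R)
    module DΣ = Sums (Dual R)

  ∑-dual : {A : Set} (xs : List A) (f : A → Carrier × Carrier) →
           DΣ.∑ xs f ≡ (∑ xs (proj₁ ∘ f) , ∑ xs (proj₂ ∘ f))
  ∑-dual []       f = refl
  ∑-dual (x ∷ xs) f = cong (f x D.+_) (∑-dual xs f)

  ∑<-dual : ∀ K (f : ℕ → Carrier × Carrier) → DΣ.∑< K f ≡ (∑< K (proj₁ ∘ f) , ∑< K (proj₂ ∘ f))
  ∑<-dual zero    f = refl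
  ∑<-dual (suc K) f = cong (f 0 D.+_) (∑<-dual K (f ∘ suc))

  ∑²-dual : ∀ K (f : ℕ → ℕ → Carrier × Carrier) →
            DΣ.∑² K f ≡ (∑² K (λ i j → proj₁ (f i j)) , ∑² K (λ i j → proj₂ (f i j)))
  ∑²-dual K f = trans (∑<-dual K _) (cong₂ _,_ (∑<-cong K (λ i _ → cong proj₁ (∑<-dual K (f i))))
                                               (∑<-cong K (λ i _ → cong proj₂ (∑<-dual K (f i)))))

  ^-dual : ∀ k x x′ → (x , x′) D.^ k ≡ (x ^ k , nat k * x ^ (k ∸ 1) * x′)
  ^-dual zero          x x′ = cong (1# ,_) (solve 1 (λ x′ → con (+ 0) := con (+ 0) :* con (+ 1) :* x′) refl x′)
  ^-dual (suc zero)    x x′ = cong (x * 1# ,_)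
    (solve 2 (λ x x′ → x :* con (+ 0) :+ x′ :* con (+ 1) := con (+ 1) :* con (+ 1) :* x′) refl x x′)
  ^-dual (suc (suc k)) x x′ = begin
    (x , x′) D.* (x , x′) D.^ suc k
      ≡⟨ cong ((x , x′) D.*_) (^-dual (suc k) x x′) ⟩
    (x * (x * x ^ k) , x * (nat (suc k) * x ^ k * x′) + x′ * (x * x ^ k))
      ≡⟨ cong (x * (x * x ^ k) ,_) (trans
           (solve 4 (λ x N X x′ → x :* (N :* X :* x′) :+ x′ :* (x :* X) := (con (+ 1) :+ N) :* (x :* X) :* x′)
                  refl x (nat (suc k)) (x ^ k) x′)
           (cong (λ t → t * (x * x ^ k) * x′) (sym (ι-+ (+ 1) (+ suc k))))) ⟩
    (x * (x * x ^ k) , nat (suc (suc k)) * (x * x ^ k) * x′) ∎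
    where open ≡-Reasoning

-- The coefficients γ

-- The exponent n − i − 2j of v in the γ-polynomial G below; the truncation of ∸ is harmless
-- because γ n i j = 0 whenever n < i + 2j.
e : ℕ → ℕ → ℕ → ℕ
e n i j = n ∸ (i ℕ.+ 2 ℕ.* j)

e-suc : ∀ n i j → i ℕ.+ 2 ℕ.* j ≤ n → e (suc n) i j ≡ suc (e n i j)
e-suc n i j = ℕP.+-∸-assoc 1

c₄ : ℕ → ℕ → ℕ → ℤ
c₄ n i j = + n ℤ.- + i ℤ.- + (2 ℕ.* suc j) ℤ.+ + 2

γ-term₁ γ-term₂ γ-term₃ γ-term₄ : ℕ → ℕ → ℕ → ℤ
γ-term₁ n zero    j = + 0
γ-term₁ n (suc i) j = γ n i j
γ-term₂ n i zero    = + 0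
γ-term₂ n i (suc j) = + suc i ℤ.* γ n (suc i) j
γ-term₃ n i j       = + j ℤ.* γ n i j
γ-term₄ n i zero    = + 0
γ-term₄ n i (suc j) = c₄ n i j ℤ.* γ n i j

γ-suc : ∀ n i j → γ (suc n) i j ≡ γ-term₁ n i j ℤ.+ γ-term₂ n i j ℤ.+ γ-term₃ n i j ℤ.+ γ-term₄ n i j
γ-suc n zero    zero    = refl
γ-suc n zero    (suc j) = refl
γ-suc n (suc i) zero    = refl
γ-suc n (suc i) (suc j) = refl

i+2[1+j]≡2+i+2j : ∀ i j → i ℕ.+ 2 ℕ.* suc j ≡ 2 ℕ.+ (i ℕ.+ 2 ℕ.* j)
i+2[1+j]≡2+i+2j = ℕ-Solver.solve-∀

e-suc-suc : ∀ n i j → e (suc n) i (suc j) ≡ e n (suc i) j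
e-suc-suc n i j = cong (suc n ∸_) (i+2[1+j]≡2+i+2j i j)

e-pred : ∀ n i j → e n (suc i) j ≡ e n i j ∸ 1
e-pred n i j = trans (cong (n ∸_) (ℕP.+-comm 1 (i ℕ.+ 2 ℕ.* j))) (sym (ℕP.∸-+-assoc n (i ℕ.+ 2 ℕ.* j) 1))

c₄≡e : ∀ n i j → i ℕ.+ 2 ℕ.* j ≤ n → c₄ n i j ≡ + e n i j
c₄≡e n i j i+2j≤n = begin
  + n ℤ.- + i ℤ.- + (2 ℕ.* suc j) ℤ.+ + 2
    ≡⟨ cong (λ m → + m ℤ.- + i ℤ.- + (2 ℕ.* suc j) ℤ.+ + 2) (ℕP.m+[n∸m]≡n i+2j≤n) ⟨
  + (i ℕ.+ 2 ℕ.* j ℕ.+ k) ℤ.- + i ℤ.- + (2 ℕ.* suc j) ℤ.+ + 2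
    ≡⟨ cong₂ (λ a b → a ℤ.- + i ℤ.- b ℤ.+ + 2)
         (trans (ℤP.pos-+ (i ℕ.+ 2 ℕ.* j) k)
                (cong (ℤ._+ + k) (trans (ℤP.pos-+ i (2 ℕ.* j)) (cong (ℤ._+_ (+ i)) (ℤP.pos-* 2 j)))))
         (trans (ℤP.pos-* 2 (suc j)) (cong ((+ 2) ℤ.*_) (ℤP.pos-+ 1 j))) ⟩
  + i ℤ.+ + 2 ℤ.* + j ℤ.+ + k ℤ.- + i ℤ.- + 2 ℤ.* (+ 1 ℤ.+ + j) ℤ.+ + 2
    ≡⟨ ℤ-identity (+ i) (+ j) (+ k) ⟩
  + k ∎
  where
  open ≡-Reasoning
  k = n ∸ (i ℕ.+ 2 ℕ.* j)
  ℤ-identity : ∀ a b c → a ℤ.+ + 2 ℤ.* b ℤ.+ c ℤ.- a ℤ.- + 2 ℤ.* (+ 1 ℤ.+ b) ℤ.+ + 2 ≡ c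
  ℤ-identity = ℤ-Solver.solve-∀

γ-vanishes : ∀ n i j → n < i ℕ.+ 2 ℕ.* j → γ n i j ≡ + 0
γ-vanishes zero    zero    zero    ()
γ-vanishes zero    zero    (suc j) _ = refl
γ-vanishes zero    (suc i) j       _ = refl
γ-vanishes (suc n) i       j       n<i+2j = trans (γ-suc n i j)
  (cong₂ ℤ._+_ (cong₂ ℤ._+_ (cong₂ ℤ._+_ (term₁ i n<i+2j) (term₂ j n<i+2j)) term₃) (term₄ j n<i+2j))
  where
  term₁ : ∀ i → suc n < i ℕ.+ 2 ℕ.* j → γ-term₁ n i j ≡ + 0
  term₁ zero    _  = refl
  term₁ (suc i) lt = γ-vanishes n i j (ℕP.≤-pred lt)
  term₂ : ∀ j → suc n < i ℕ.+ 2 ℕ.* j → γ-term₂ n i j ≡ + 0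
  term₂ zero    _  = refl
  term₂ (suc j) lt = trans
    (cong (+ suc i ℤ.*_) (γ-vanishes n (suc i) j (ℕP.≤-pred (subst (suc n <_) (i+2[1+j]≡2+i+2j i j) lt))))
    (ℤP.*-zeroʳ (+ suc i))
  term₃ : γ-term₃ n i j ≡ + 0
  term₃ = trans (cong (+ j ℤ.*_) (γ-vanishes n i j (ℕP.<-trans (ℕP.n<1+n n) n<i+2j))) (ℤP.*-zeroʳ (+ j))
  term₄ : ∀ j → suc n < i ℕ.+ 2 ℕ.* j → γ-term₄ n i j ≡ + 0
  term₄ zero    _  = refl
  term₄ (suc j) lt with ℕP.m≤n⇒m<n∨m≡n (ℕP.≤-pred (ℕP.≤-pred (subst (suc n <_) (i+2[1+j]≡2+i+2j i j) lt)))
  ... | inj₁ n<i+2j = trans (cong (c₄ n i j ℤ.*_) (γ-vanishes n i j n<i+2j)) (ℤP.*-zeroʳ (c₄ n i j))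
  ... | inj₂ n≡i+2j = trans
    (cong (ℤ._* γ n i j) (trans (c₄≡e n i j (ℕP.≤-reflexive (sym n≡i+2j)))
                                (cong +_ (ℕP.m≤n⇒m∸n≡0 (ℕP.≤-reflexive n≡i+2j)))))
    (ℤP.*-zeroˡ (γ n i j))

module GammaPolynomial (R : CommRing) where
  open CommRing R
  open CommRingProperties R
  open Sums R
  open ≡-Reasoning

  monomial : ℕ → ℕ → ℕ → Carrier → Carrier → Carrier → Carrier
  monomial n i j u v w = u ^ j * (v ^ e n i j * w ^ i)

  G ∂uG ∂vG ∂wG : ℕ → Carrier → Carrier → Carrier → Carrier
  G   n u v w = ∑² (suc n) (λ i j → ι (γ n i j) * monomial n i j u v w)
  ∂uG n u v w = ∑² (suc n) (λ i j → ι (γ n i j) * (nat j * u ^ (j ∸ 1) * (v ^ e n i j * w ^ i)))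
  ∂vG n u v w = ∑² (suc n) (λ i j → ι (γ n i j) * (u ^ j * (nat (e n i j) * v ^ (e n i j ∸ 1) * w ^ i)))
  ∂wG n u v w = ∑² (suc n) (λ i j → ι (γ n i j) * (u ^ j * (v ^ e n i j * (nat i * w ^ (i ∸ 1)))))

  G-part : (ℕ → ℕ → ℕ → ℤ) → ℕ → Carrier → Carrier → Carrier → Carrier
  G-part a n u v w = ∑² (suc (suc n)) (λ i j → ι (a n i j) * monomial (suc n) i j u v w)

  γ-vanishes-* : ∀ n i j x → n < i ℕ.+ 2 ℕ.* j → ι (γ n i j) * x ≡ 0#
  γ-vanishes-* n i j x n<i+2j = trans (cong (λ c → ι c * x) (γ-vanishes n i j n<i+2j)) (zeroˡ x)

  i-large : ∀ {n} i j → suc n ≤ i → n < i ℕ.+ 2 ℕ.* j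
  i-large i j n<i = ℕP.≤-trans n<i (ℕP.m≤m+n i _)

  j-large : ∀ {n} i j → suc n ≤ j → n < i ℕ.+ 2 ℕ.* j
  j-large i j n<j = ℕP.≤-trans n<j (ℕP.≤-trans (ℕP.m≤m+n j _) (ℕP.m≤n+m (2 ℕ.* j) i))

  G-term₁ : ∀ n u v w → G-part γ-term₁ n u v w ≡ w * G n u v w
  G-term₁ n u v w = begin
    ∑² (suc (suc n)) t
      ≡⟨ ∑<-head-zero (suc n) (λ i → ∑< (suc (suc n)) (t i))
                      (∑<-zero (suc (suc n)) (t 0) (λ j _ → zeroˡ _)) ⟩
    ∑< (suc n) (λ i → ∑< (suc (suc n)) (t (suc i)))
      ≡⟨ ∑<-cong (suc n) (λ i _ → ∑<-vanishing-tail (t (suc i)) (ℕP.n≤1+n _)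
                                     (λ j n<j → γ-vanishes-* n i j _ (j-large i j n<j))) ⟩
    ∑² (suc n) (λ i j → ι (γ n i j) * monomial (suc n) (suc i) j u v w)
      ≡⟨ ∑²-cong (suc n) (λ i j →
           solve 5 (λ g U V w W → g :* (U :* (V :* (w :* W))) := w :* (g :* (U :* (V :* W))))
                 refl (ι (γ n i j)) (u ^ j) (v ^ e n i j) w (w ^ i)) ⟩
    ∑² (suc n) (λ i j → w * (ι (γ n i j) * monomial n i j u v w))
      ≡⟨ ∑²-*ˡ (suc n) w (λ i j → ι (γ n i j) * monomial n i j u v w) ⟩
    w * G n u v w ∎
    where
    t : ℕ → ℕ → Carrier
    t i j = ι (γ-term₁ n i j) * monomial (suc n) i j u v w

  G-term₂ : ∀ n u v w → G-part γ-term₂ n u v w ≡ u * ∂wG n u v w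
  G-term₂ n u v w = begin
    ∑² (suc (suc n)) t
      ≡⟨ ∑<-cong (suc (suc n)) (λ i _ → ∑<-head-zero (suc n) (t i) (zeroˡ _)) ⟩
    ∑< (suc (suc n)) (λ i → ∑< (suc n) (t i ∘ suc))
      ≡⟨ ∑<-vanishing-tail _ (ℕP.≤-trans (ℕP.n≤1+n n) (ℕP.n≤1+n _))
           (λ i n≤i → ∑<-zero (suc n) (t i ∘ suc) (λ j _ → t-vanishes i j n≤i)) ⟩
    ∑< n (λ i → ∑< (suc n) (t i ∘ suc))
      ≡⟨ ∑<-cong n (λ i _ → trans (∑<-cong (suc n) (λ j _ → t≡u*h i j)) (∑<-*ˡ (suc n) u (h (suc i)))) ⟩
    ∑< n (λ i → u * ∑< (suc n) (h (suc i)))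
      ≡⟨ ∑<-*ˡ n u _ ⟩
    u * ∑< n (λ i → ∑< (suc n) (h (suc i)))
      ≡⟨ cong (u *_) (∑<-head-zero n (λ i → ∑< (suc n) (h i))
                                     (∑<-zero (suc n) (h 0) (λ j _ → h₀≡0 j))) ⟨
    u * ∂wG n u v w ∎
    where
    t h : ℕ → ℕ → Carrier
    t i j = ι (γ-term₂ n i j) * monomial (suc n) i j u v w
    h i j = ι (γ n i j) * (u ^ j * (v ^ e n i j * (nat i * w ^ (i ∸ 1))))
    t-vanishes : ∀ i j → n ≤ i → t i (suc j) ≡ 0#
    t-vanishes i j n≤i = trans
      (cong (λ c → ι c * monomial (suc n) i (suc j) u v w)
        (trans (cong (+ suc i ℤ.*_) (γ-vanishes n (suc i) j (s≤s (ℕP.≤-trans n≤i (ℕP.m≤m+n i _)))))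
               (ℤP.*-zeroʳ (+ suc i))))
      (zeroˡ _)
    t≡u*h : ∀ i j → t i (suc j) ≡ u * h (suc i) j
    t≡u*h i j = begin
      ι (+ suc i ℤ.* γ n (suc i) j) * (u * u ^ j * (v ^ e (suc n) i (suc j) * w ^ i))
        ≡⟨ cong₂ (λ c k → c * (u * u ^ j * (v ^ k * w ^ i))) (ι-* (+ suc i) (γ n (suc i) j)) (e-suc-suc n i j) ⟩
      nat (suc i) * ι (γ n (suc i) j) * (u * u ^ j * (v ^ e n (suc i) j * w ^ i))
        ≡⟨ solve 6 (λ N g u U V W → N :* g :* (u :* U :* (V :* W)) := u :* (g :* (U :* (V :* (N :* W)))))
                 refl (nat (suc i)) (ι (γ n (suc i) j)) u (u ^ j) (v ^ e n (suc i) j) (w ^ i) ⟩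
      u * h (suc i) j ∎
    h₀≡0 : ∀ j → h 0 j ≡ 0#
    h₀≡0 j = solve 4 (λ g U V W → g :* (U :* (V :* (con (+ 0) :* W))) := con (+ 0))
                   refl (ι (γ n 0 j)) (u ^ j) (v ^ e n 0 j) (w ^ 0)

  G-term₃ : ∀ n u v w → G-part γ-term₃ n u v w ≡ u * v * ∂uG n u v w
  G-term₃ n u v w = begin
    ∑² (suc (suc n)) t
      ≡⟨ ∑<-vanishing-tail _ (ℕP.n≤1+n _)
           (λ i n<i → ∑<-zero (suc (suc n)) (t i) (λ j _ → t-vanishes i j (i-large i j n<i))) ⟩
    ∑< (suc n) (λ i → ∑< (suc (suc n)) (t i))
      ≡⟨ ∑<-cong (suc n) (λ i _ → ∑<-vanishing-tail (t i) (ℕP.n≤1+n _)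
                                     (λ j n<j → t-vanishes i j (j-large i j n<j))) ⟩
    ∑² (suc n) t
      ≡⟨ ∑²-cong (suc n) t≡u*v*h ⟩
    ∑² (suc n) (λ i j → u * v * h i j)
      ≡⟨ ∑²-*ˡ (suc n) (u * v) h ⟩
    u * v * ∂uG n u v w ∎
    where
    t h : ℕ → ℕ → Carrier
    t i j = ι (γ-term₃ n i j) * monomial (suc n) i j u v w
    h i j = ι (γ n i j) * (nat j * u ^ (j ∸ 1) * (v ^ e n i j * w ^ i))
    t-vanishes : ∀ i j → n < i ℕ.+ 2 ℕ.* j → t i j ≡ 0#
    t-vanishes i j n<i+2j = trans
      (cong (λ c → ι c * monomial (suc n) i j u v w)
        (trans (cong (+ j ℤ.*_) (γ-vanishes n i j n<i+2j)) (ℤP.*-zeroʳ (+ j))))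
      (zeroˡ _)
    t≡u*v*h : ∀ i j → t i j ≡ u * v * h i j
    t≡u*v*h i j with i ℕ.+ 2 ℕ.* j ℕP.≤? n
    ... | no i+2j≰n = trans (t-vanishes i j (ℕP.≰⇒> i+2j≰n))
      (sym (trans (cong (u * v *_) (γ-vanishes-* n i j _ (ℕP.≰⇒> i+2j≰n))) (zeroʳ (u * v))))
    ... | yes i+2j≤n = trans
      (cong₂ (λ c k → c * (u ^ j * (v ^ k * w ^ i))) (ι-* (+ j) (γ n i j)) (e-suc n i j i+2j≤n))
      (by-j j)
      where
      by-j : ∀ j′ → nat j′ * ι (γ n i j) * (u ^ j′ * (v * v ^ e n i j * w ^ i))
                    ≡ u * v * (ι (γ n i j) * (nat j′ * u ^ (j′ ∸ 1) * (v ^ e n i j * w ^ i)))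
      by-j zero     = solve 6 (λ g U u v V W → con (+ 0) :* g :* (U :* (v :* V :* W))
                                              := u :* v :* (g :* (con (+ 0) :* U :* (V :* W))))
                            refl (ι (γ n i j)) 1# u v (v ^ e n i j) (w ^ i)
      by-j (suc j′) = solve 7 (λ N g U u v V W → N :* g :* (u :* U :* (v :* V :* W))
                                                := u :* v :* (g :* (N :* U :* (V :* W))))
                            refl (nat (suc j′)) (ι (γ n i j)) (u ^ j′) u v (v ^ e n i j) (w ^ i)

  G-term₄ : ∀ n u v w → G-part γ-term₄ n u v w ≡ u * ∂vG n u v w
  G-term₄ n u v w = begin
    ∑² (suc (suc n)) t
      ≡⟨ ∑<-cong (suc (suc n)) (λ i _ → ∑<-head-zero (suc n) (t i) (zeroˡ _)) ⟩
    ∑< (suc (suc n)) (λ i → ∑< (suc n) (t i ∘ suc))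
      ≡⟨ ∑<-vanishing-tail _ (ℕP.n≤1+n _)
           (λ i n<i → ∑<-zero (suc n) (t i ∘ suc) (λ j _ → t-vanishes i j (i-large i j n<i))) ⟩
    ∑² (suc n) (λ i j → t i (suc j))
      ≡⟨ ∑²-cong (suc n) t≡u*h ⟩
    ∑² (suc n) (λ i j → u * h i j)
      ≡⟨ ∑²-*ˡ (suc n) u h ⟩
    u * ∂vG n u v w ∎
    where
    t h : ℕ → ℕ → Carrier
    t i j = ι (γ-term₄ n i j) * monomial (suc n) i j u v w
    h i j = ι (γ n i j) * (u ^ j * (nat (e n i j) * v ^ (e n i j ∸ 1) * w ^ i))
    t-vanishes : ∀ i j → n < i ℕ.+ 2 ℕ.* j → t i (suc j) ≡ 0#
    t-vanishes i j n<i+2j = trans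
      (cong (λ d → ι d * monomial (suc n) i (suc j) u v w)
        (trans (cong (c₄ n i j ℤ.*_) (γ-vanishes n i j n<i+2j)) (ℤP.*-zeroʳ (c₄ n i j))))
      (zeroˡ _)
    t≡u*h : ∀ i j → t i (suc j) ≡ u * h i j
    t≡u*h i j with i ℕ.+ 2 ℕ.* j ℕP.≤? n
    ... | no i+2j≰n = trans (t-vanishes i j (ℕP.≰⇒> i+2j≰n))
      (sym (trans (cong (u *_) (γ-vanishes-* n i j _ (ℕP.≰⇒> i+2j≰n))) (zeroʳ u)))
    ... | yes i+2j≤n = begin
      ι (c₄ n i j ℤ.* γ n i j) * (u * u ^ j * (v ^ e (suc n) i (suc j) * w ^ i))
        ≡⟨ cong₂ (λ d k → d * (u * u ^ j * (v ^ k * w ^ i)))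
             (trans (cong (λ d → ι (d ℤ.* γ n i j)) (c₄≡e n i j i+2j≤n)) (ι-* _ (γ n i j)))
             (trans (e-suc-suc n i j) (e-pred n i j)) ⟩
      nat (e n i j) * ι (γ n i j) * (u * u ^ j * (v ^ (e n i j ∸ 1) * w ^ i))
        ≡⟨ solve 6 (λ N g u U V W → N :* g :* (u :* U :* (V :* W)) := u :* (g :* (U :* (N :* V :* W))))
                 refl (nat (e n i j)) (ι (γ n i j)) u (u ^ j) (v ^ (e n i j ∸ 1)) (w ^ i) ⟩
      u * h i j ∎

  G-suc : ∀ n u v w → G (suc n) u v w ≡ w * G n u v w + u * ∂wG n u v w + u * v * ∂uG n u v w + u * ∂vG n u v w
  G-suc n u v w = begin
    G (suc n) u v w
      ≡⟨ ∑²-cong K split ⟩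
    ∑² K (λ i j → t γ-term₁ i j + t γ-term₂ i j + t γ-term₃ i j + t γ-term₄ i j)
      ≡⟨ ∑²-+ K (λ i j → t γ-term₁ i j + t γ-term₂ i j + t γ-term₃ i j) (t γ-term₄) ⟩
    ∑² K (λ i j → t γ-term₁ i j + t γ-term₂ i j + t γ-term₃ i j) + part γ-term₄
      ≡⟨ cong (_+ part γ-term₄) (trans (∑²-+ K (λ i j → t γ-term₁ i j + t γ-term₂ i j) (t γ-term₃))
                                       (cong (_+ part γ-term₃) (∑²-+ K (t γ-term₁) (t γ-term₂)))) ⟩
    part γ-term₁ + part γ-term₂ + part γ-term₃ + part γ-term₄
      ≡⟨ cong₂ _+_ (cong₂ _+_ (cong₂ _+_ (G-term₁ n u v w) (G-term₂ n u v w)) (G-term₃ n u v w))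
                   (G-term₄ n u v w) ⟩
    w * G n u v w + u * ∂wG n u v w + u * v * ∂uG n u v w + u * ∂vG n u v w ∎
    where
    K = suc (suc n)
    t : (ℕ → ℕ → ℕ → ℤ) → ℕ → ℕ → Carrier
    t a i j = ι (a n i j) * monomial (suc n) i j u v w
    part : (ℕ → ℕ → ℕ → ℤ) → Carrier
    part a = G-part a n u v w
    split : ∀ i j → ι (γ (suc n) i j) * monomial (suc n) i j u v w
                    ≡ t γ-term₁ i j + t γ-term₂ i j + t γ-term₃ i j + t γ-term₄ i j
    split i j = begin
      ι (γ (suc n) i j) * m
        ≡⟨ cong (λ c → ι c * m) (γ-suc n i j) ⟩
      ι (γ-term₁ n i j ℤ.+ γ-term₂ n i j ℤ.+ γ-term₃ n i j ℤ.+ γ-term₄ n i j) * m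
        ≡⟨ cong (_* m) (trans (ι-+ _ _) (cong (_+ _) (trans (ι-+ _ _) (cong (_+ _) (ι-+ _ _))))) ⟩
      (ι (γ-term₁ n i j) + ι (γ-term₂ n i j) + ι (γ-term₃ n i j) + ι (γ-term₄ n i j)) * m
        ≡⟨ solve 5 (λ a b c d m → (a :+ b :+ c :+ d) :* m := a :* m :+ b :* m :+ c :* m :+ d :* m)
                 refl (ι (γ-term₁ n i j)) (ι (γ-term₂ n i j)) (ι (γ-term₃ n i j)) (ι (γ-term₄ n i j)) m ⟩
      t γ-term₁ i j + t γ-term₂ i j + t γ-term₃ i j + t γ-term₄ i j ∎
      where m = monomial (suc n) i j u v w

module GammaPolynomialDual (R : CommRing) where
  open CommRing R
  open CommRingProperties R
  open Sums R
  open DualProperties R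
  open GammaPolynomial R
  private
    module D = CommRing (Dual R)
    module DG = GammaPolynomial (Dual R)

  G-dual : ∀ n u a v b w c → DG.G n (u , a) (v , b) (w , c)
                              ≡ (G n u v w , a * ∂uG n u v w + b * ∂vG n u v w + c * ∂wG n u v w)
  G-dual n u a v b w c = begin
    DG.G n (u , a) (v , b) (w , c)
      ≡⟨ ∑²-dual K t ⟩
    (∑² K (λ i j → proj₁ (t i j)) , ∑² K (λ i j → proj₂ (t i j)))
      ≡⟨ cong₂ _,_ (∑²-cong K (λ i j → cong proj₁ (t≡ i j)))
                   (∑²-cong K (λ i j → trans (cong proj₂ (t≡ i j)) (product-rule i j))) ⟩
    (G n u v w , ∑² K (λ i j → a * hu i j + b * hv i j + c * hw i j))
      ≡⟨ cong (G n u v w ,_) (trans (∑²-+ K (λ i j → a * hu i j + b * hv i j) (λ i j → c * hw i j))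
           (cong₂ _+_ (trans (∑²-+ K (λ i j → a * hu i j) (λ i j → b * hv i j))
                             (cong₂ _+_ (∑²-*ˡ K a hu) (∑²-*ˡ K b hv)))
                      (∑²-*ˡ K c hw))) ⟩
    (G n u v w , a * ∂uG n u v w + b * ∂vG n u v w + c * ∂wG n u v w) ∎
    where
    open ≡-Reasoning
    K = suc n
    t : ℕ → ℕ → Carrier × Carrier
    t i j = D.ι (γ n i j) D.* DG.monomial n i j (u , a) (v , b) (w , c)
    hu hv hw : ℕ → ℕ → Carrier
    hu i j = ι (γ n i j) * (nat j * u ^ (j ∸ 1) * (v ^ e n i j * w ^ i))
    hv i j = ι (γ n i j) * (u ^ j * (nat (e n i j) * v ^ (e n i j ∸ 1) * w ^ i))
    hw i j = ι (γ n i j) * (u ^ j * (v ^ e n i j * (nat i * w ^ (i ∸ 1))))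
    t≡ : ∀ i j → t i j ≡ D.ι (γ n i j) D.* ((u ^ j , nat j * u ^ (j ∸ 1) * a)
                          D.* ((v ^ e n i j , nat (e n i j) * v ^ (e n i j ∸ 1) * b)
                          D.* (w ^ i , nat i * w ^ (i ∸ 1) * c)))
    t≡ i j = cong₂ (λ p q → D.ι (γ n i j) D.* (p D.* q)) (^-dual j u a)
                   (cong₂ D._*_ (^-dual (e n i j) v b) (^-dual i w c))
    product-rule : ∀ i j → proj₂ (D.ι (γ n i j) D.* ((u ^ j , nat j * u ^ (j ∸ 1) * a)
                                  D.* ((v ^ e n i j , nat (e n i j) * v ^ (e n i j ∸ 1) * b)
                                  D.* (w ^ i , nat i * w ^ (i ∸ 1) * c))))
                           ≡ a * hu i j + b * hv i j + c * hw i j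
    product-rule i j = solve 13 (λ g U Nj U₁ a V Nk V₁ b W Ni W₁ c →
        g :* (U :* (V :* (Ni :* W₁ :* c) :+ Nk :* V₁ :* b :* W) :+ Nj :* U₁ :* a :* (V :* W))
          :+ con (+ 0) :* (U :* (V :* W))
        := a :* (g :* (Nj :* U₁ :* (V :* W))) :+ b :* (g :* (U :* (Nk :* V₁ :* W)))
          :+ c :* (g :* (U :* (V :* (Ni :* W₁)))))
      refl (ι (γ n i j)) (u ^ j) (nat j) (u ^ (j ∸ 1)) a (v ^ e n i j) (nat (e n i j)) (v ^ (e n i j ∸ 1)) b
           (w ^ i) (nat i) (w ^ (i ∸ 1)) c

Q : ℕ → Poly₃
Q n R X Y Z = GammaPolynomial.G R n (ι (+ 2) * X * Y) (X + Y) (Y + Z)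
  where open CommRing R

-- ∂(2XY) = 2(X + Y) and ∂(X + Y) = ∂(Y + Z) = 2, so XY ∂Q = u (v ∂uG + ∂vG + ∂wG) with u = 2XY.
Q-recurrence : Recurrence (λ R X Y Z → CommRing._+_ R Y Z) Q
Q-recurrence n R X Y Z = begin
  G (suc n) u v w
    ≡⟨ G-suc n u v w ⟩
  w * G n u v w + u * ∂wG n u v w + u * v * ∂uG n u v w + u * ∂vG n u v w
    ≡⟨ solve 7 (λ X Y Z g gu gv gw →
         (Y :+ Z) :* g :+ con (+ 2) :* X :* Y :* gw :+ con (+ 2) :* X :* Y :* (X :+ Y) :* gu :+ con (+ 2) :* X :* Y :* gv
         := (Y :+ Z) :* g
            :+ X :* Y :* ((con (+ 2) :* X :* con (+ 1) :+ (con (+ 2) :* con (+ 1) :+ con (+ 0) :* X) :* Y) :* gu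
                          :+ (con (+ 1) :+ con (+ 1)) :* gv :+ (con (+ 1) :+ con (+ 1)) :* gw))
         refl X Y Z (G n u v w) (∂uG n u v w) (∂vG n u v w) (∂wG n u v w) ⟩
  w * G n u v w + X * Y * (proj₂ u′ * ∂uG n u v w + (1# + 1#) * ∂vG n u v w + (1# + 1#) * ∂wG n u v w)
    ≡⟨ cong (λ d → w * G n u v w + X * Y * d)
            (cong proj₂ (GammaPolynomialDual.G-dual R n u (proj₂ u′) v (1# + 1#) w (1# + 1#))) ⟨
  w * Q n R X Y Z + X * Y * ∂ (Q n) R X Y Z ∎
  where
  open CommRing R
  open CommRingProperties R
  open GammaPolynomial R
  open ≡-Reasoning
  u = ι (+ 2) * X * Y
  v = X + Y
  w = Y + Z
  module D = CommRing (Dual R)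
  u′ : Carrier × Carrier
  u′ = D.ι (+ 2) D.* _+ε {R} X D.* _+ε {R} Y

words-suc : ∀ n k → words (suc n) k ≡ cartesianProductWith _∷_ (upTo k) (words n k)
words-suc n k = concatMap≡cartesianProductWith (upTo k)
  where
  concatMap≡cartesianProductWith : ∀ xs → concatMap (λ a → map (a ∷_) (words n k)) xs
                                          ≡ cartesianProductWith _∷_ xs (words n k)
  concatMap≡cartesianProductWith []       = refl
  concatMap≡cartesianProductWith (x ∷ xs) = cong (map (x ∷_) (words n k) ++_) (concatMap≡cartesianProductWith xs)

words-unique : ∀ n k → Unique (words n k)
words-unique zero    k = [] ∷ []
words-unique (suc n) k rewrite words-suc n k =
  Uniqueₚ.cartesianProductWith⁺ _∷_ ∷-injective (Uniqueₚ.upTo⁺ k) (words-unique n k)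
  where
  ∷-injective : ∀ {a b : ℕ} {as bs} → a ∷ as ≡ b ∷ bs → a ≡ b × as ≡ bs
  ∷-injective refl = refl , refl

∈-words⁺ : ∀ n k {w} → length w ≡ n → All (_< k) w → w ∈ words n k
∈-words⁺ zero    k {[]}    refl []          = here refl
∈-words⁺ (suc n) k {a ∷ w} refl (a<k ∷ w<k) rewrite words-suc n k =
  ∈-cartesianProductWith⁺ _∷_ (∈-upTo⁺ a<k) (∈-words⁺ n k refl w<k)

∈-words⁻ : ∀ n k {w} → w ∈ words n k → length w ≡ n × All (_< k) w
∈-words⁻ zero    k (here refl) = refl , []
∈-words⁻ (suc n) k w∈ rewrite words-suc n k with ∈-cartesianProductWith⁻ _∷_ (upTo k) (words n k) w∈
... | a , w , a∈ , w∈′ , refl with ∈-words⁻ n k w∈′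
... | refl , w<k = refl , ∈-upTo⁻ a∈ ∷ w<k

elem≡false⇒∉ : ∀ a as → elem a as ≡ false → a ∉ as
elem≡false⇒∉ a (b ∷ bs) eq a∈ with a ℕ.≟ b | a∈
... | yes _   | _          = case eq of λ ()
... | no a≢b  | here a≡b   = a≢b a≡b
... | no _    | there a∈bs = elem≡false⇒∉ a bs eq a∈bs

∉⇒elem≡false : ∀ a as → a ∉ as → elem a as ≡ false
∉⇒elem≡false a []       _   = refl
∉⇒elem≡false a (b ∷ bs) a∉ with a ℕ.≟ b
... | yes a≡b = ⊥-elim (a∉ (here a≡b))
... | no _    = ∉⇒elem≡false a bs (a∉ ∘ there)

distinct⇒Unique : ∀ w → distinct w ≡ true → Unique w
distinct⇒Unique []       _  = []
distinct⇒Unique (a ∷ as) eq with elem a as in elem≡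
... | false = ¬Any⇒All¬ as (elem≡false⇒∉ a as elem≡) ∷ distinct⇒Unique as eq

Unique⇒distinct : ∀ w → Unique w → distinct w ≡ true
Unique⇒distinct []       _          = refl
Unique⇒distinct (a ∷ as) (a∉ ∷ !as) rewrite ∉⇒elem≡false a as (All¬⇒¬Any a∉) = Unique⇒distinct as !as

IsPerm : ℕ → List ℕ → Set
IsPerm n w = length w ≡ n × All (_< n) w × Unique w

∈-Perm⁻ : ∀ n {w} → w ∈ Perm n → IsPerm n w
∈-Perm⁻ n {w} w∈ with ∈-filter⁻ (λ w → distinct w Bool.≟ true) {xs = words n n} w∈
... | w∈words , distinct-w with ∈-words⁻ n n w∈words
... | length-w , w<n = length-w , w<n , distinct⇒Unique w distinct-w

∈-Perm⁺ : ∀ n {w} → IsPerm n w → w ∈ Perm n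
∈-Perm⁺ n {w} (length-w , w<n , !w) =
  ∈-filter⁺ (λ w → distinct w Bool.≟ true) (∈-words⁺ n n length-w w<n) (Unique⇒distinct w !w)

Perm-unique : ∀ n → Unique (Perm n)
Perm-unique n = Uniqueₚ.filter⁺ (λ w → distinct w Bool.≟ true) (words-unique n n)

Unique-resp-↭ : ∀ {xs ys : List ℕ} → xs ↭ ys → Unique xs → Unique ys
Unique-resp-↭ p = ↭ₛ.Unique-resp-↭ (↭⇒↭ₛ p)

All<-suc-∉ : ∀ {m} w → All (_< suc m) w → m ∉ w → All (_< m) w
All<-suc-∉ []      []          _  = []
All<-suc-∉ (a ∷ w) (a<1+m ∷ w<1+m) m∉ with ℕP.m≤n⇒m<n∨m≡n (ℕP.≤-pred a<1+m)
... | inj₁ a<m  = a<m ∷ All<-suc-∉ w w<1+m (m∉ ∘ there)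
... | inj₂ refl = ⊥-elim (m∉ (here refl))

All<⇒∉ : ∀ {m} w → All (_< m) w → m ∉ w
All<⇒∉ (a ∷ w) (a<m ∷ _)   (here refl) = ℕP.<-irrefl refl a<m
All<⇒∉ (a ∷ w) (_   ∷ w<m) (there m∈w) = All<⇒∉ w w<m m∈w

Unique∧All<-drop-max : ∀ {m σ π} → π ↭ m ∷ σ → Unique π → All (_< suc m) π → Unique σ × All (_< m) σ
Unique∧All<-drop-max {m} {σ} p !π π<1+m =
  AllPairs.tail !m∷σ , All<-suc-∉ σ (All.tail (↭ₚ.All-resp-↭ p π<1+m)) (All¬⇒¬Any (AllPairs.head !m∷σ))
  where
  !m∷σ : Unique (m ∷ σ)
  !m∷σ = Unique-resp-↭ p !π

unique-bounded⇒length≤ : ∀ k w → Unique w → All (_< k) w → length w ≤ k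
unique-bounded⇒length≤ zero    []      _  _         = z≤n
unique-bounded⇒length≤ zero    (a ∷ w) _  (() ∷ _)
unique-bounded⇒length≤ (suc k) w       !w w<1+k with any? (k ℕ.≟_) w
... | no  k∉w = ℕP.m≤n⇒m≤1+n (unique-bounded⇒length≤ k w !w (All<-suc-∉ w w<1+k k∉w))
... | yes k∈w with ∈-∃++ k∈w
... | ys , zs , refl with Unique∧All<-drop-max (↭ₚ.shift k ys zs) !w w<1+k
... | !rest , rest<k = subst (_≤ suc k) (sym (↭ₚ.↭-length (↭ₚ.shift k ys zs)))
  (s≤s (unique-bounded⇒length≤ k (ys ++ zs) !rest rest<k))

IsPerm-suc⇒max∈ : ∀ m {π} → IsPerm (suc m) π → m ∈ π
IsPerm-suc⇒max∈ m {π} (length-π , π<1+m , !π) with any? (m ℕ.≟_) π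
... | yes m∈π = m∈π
... | no  m∉π = ⊥-elim (ℕP.<-irrefl refl
  (subst (_≤ m) length-π (unique-bounded⇒length≤ m π !π (All<-suc-∉ π π<1+m m∉π))))

IsPerm-add-max : ∀ m {σ π} → IsPerm m σ → π ↭ m ∷ σ → IsPerm (suc m) π
IsPerm-add-max m {σ} (length-σ , σ<m , !σ) p =
  trans (↭ₚ.↭-length p) (cong suc length-σ) ,
  ↭ₚ.All-resp-↭ (↭.↭-sym p) (ℕP.n<1+n m ∷ All.map ℕP.m≤n⇒m≤1+n σ<m) ,
  Unique-resp-↭ (↭.↭-sym p) (¬Any⇒All¬ σ (All<⇒∉ σ σ<m) ∷ !σ)

IsPerm-drop-max : ∀ m {σ π} → IsPerm (suc m) π → π ↭ m ∷ σ → IsPerm m σ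
IsPerm-drop-max m {σ} (length-π , π<1+m , !π) p =
  ℕP.suc-injective (trans (sym (↭ₚ.↭-length p)) length-π) , proj₂ σ-facts , proj₁ σ-facts
  where
  σ-facts : Unique σ × All (_< m) σ
  σ-facts = Unique∧All<-drop-max p !π π<1+m

Unique-map⁺ : {A B : Set} (f : A → B) {xs : List A} →
              (∀ {x y} → x ∈ xs → y ∈ xs → f x ≡ f y → x ≡ y) → Unique xs → Unique (map f xs)
Unique-map⁺ f {[]}     injective []         = []
Unique-map⁺ f {x ∷ xs} injective (x∉ ∷ !xs) =
  Allₚ.map⁺ (All.tabulate (λ y∈xs fx≡fy → All.lookup x∉ y∈xs (injective (here refl) (there y∈xs) fx≡fy)))
  ∷ Unique-map⁺ f (λ x∈ y∈ → injective (there x∈) (there y∈)) !xs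

record InsertionBijection (m : ℕ) : Set where
  field
    insert         : List ℕ → ℕ → List ℕ
    extract        : List ℕ → List ℕ × ℕ
    insert-↭       : ∀ σ k → insert σ k ↭ m ∷ σ
    extract-insert : ∀ σ k → IsPerm m σ → k < suc m → extract (insert σ k) ≡ (σ , k)
    extract-<      : ∀ π → IsPerm (suc m) π → proj₂ (extract π) < suc m
    insert-extract : ∀ π → IsPerm (suc m) π → insert (proj₁ (extract π)) (proj₂ (extract π)) ≡ π

module PermSums (R : CommRing) where
  open CommRing R
  open Sums R

  ∑-Perm-suc : ∀ {m} (B : InsertionBijection m) (F : List ℕ → Carrier) →
               ∑ (Perm (suc m)) F ≡ ∑ (Perm m) (λ σ → ∑< (suc m) (λ k → F (InsertionBijection.insert B σ k)))
  ∑-Perm-suc {m} B F = begin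
    ∑ (Perm (suc m)) F                                     ≡⟨ ∑-↭ F Perm[1+m]↭image ⟩
    ∑ (map (uncurry insert) pairs) F                       ≡⟨ ∑-map (uncurry insert) pairs F ⟩
    ∑ pairs (F ∘ uncurry insert)                           ≡⟨ ∑-cartesianProduct (Perm m) (upTo (suc m)) _ ⟩
    ∑ (Perm m) (λ σ → ∑ (upTo (suc m)) (F ∘ insert σ))    ≡⟨ ∑-cong (Perm m) (λ σ _ → ∑-upTo (suc m) _) ⟩
    ∑ (Perm m) (λ σ → ∑< (suc m) (F ∘ insert σ))          ∎
    where
    open ≡-Reasoning
    open InsertionBijection B
    pairs : List (List ℕ × ℕ)
    pairs = cartesianProduct (Perm m) (upTo (suc m))
    ∈-pairs⁻ : ∀ {σ k} → (σ , k) ∈ pairs → IsPerm m σ × k < suc m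
    ∈-pairs⁻ σk∈ with ∈-cartesianProductWith⁻ _,_ (Perm m) (upTo (suc m)) σk∈
    ... | _ , _ , σ∈ , k∈ , refl = ∈-Perm⁻ m σ∈ , ∈-upTo⁻ k∈
    insert-injective : ∀ {p q} → p ∈ pairs → q ∈ pairs → uncurry insert p ≡ uncurry insert q → p ≡ q
    insert-injective {σ , k} {τ , l} p∈ q∈ eq =
      trans (sym (uncurry (extract-insert σ k) (∈-pairs⁻ p∈)))
            (trans (cong extract eq) (uncurry (extract-insert τ l) (∈-pairs⁻ q∈)))
    IsPerm-insert : ∀ {σ k} → IsPerm m σ → IsPerm (suc m) (insert σ k)
    IsPerm-insert {σ} {k} σ-perm = IsPerm-add-max m σ-perm (insert-↭ σ k)
    IsPerm-extract : ∀ π → IsPerm (suc m) π → IsPerm m (proj₁ (extract π))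
    IsPerm-extract π π-perm = IsPerm-drop-max m π-perm
      (subst (_↭ m ∷ proj₁ (extract π)) (insert-extract π π-perm) (insert-↭ _ _))
    to : ∀ {π} → π ∈ Perm (suc m) → π ∈ map (uncurry insert) pairs
    to {π} π∈ = subst (_∈ map (uncurry insert) pairs) (insert-extract π π-perm)
      (∈-map⁺ (uncurry insert) (∈-cartesianProductWith⁺ _,_ (∈-Perm⁺ m (IsPerm-extract π π-perm))
                                                              (∈-upTo⁺ (extract-< π π-perm))))
      where
      π-perm : IsPerm (suc m) π
      π-perm = ∈-Perm⁻ (suc m) π∈
    from : ∀ {π} → π ∈ map (uncurry insert) pairs → π ∈ Perm (suc m)
    from π∈ with ∈-map⁻ (uncurry insert) π∈
    ... | (σ , k) , σk∈ , refl = ∈-Perm⁺ (suc m) (IsPerm-insert (proj₁ (∈-pairs⁻ σk∈)))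
    Perm[1+m]↭image : Perm (suc m) ↭ map (uncurry insert) pairs
    Perm[1+m]↭image = ∼bag⇒↭ (unique∧set⇒bag (Perm-unique (suc m))
      (Unique-map⁺ (uncurry insert) insert-injective
                   (Uniqueₚ.cartesianProduct⁺ (Perm-unique m) (Uniqueₚ.upTo⁺ (suc m))))
      (mk⇔ to from))

-- Inserting the largest letter into a word

insertAt : ℕ → ℕ → List ℕ → List ℕ
insertAt zero    m σ       = m ∷ σ
insertAt (suc k) m []      = m ∷ []
insertAt (suc k) m (a ∷ σ) = a ∷ insertAt k m σ

remove : ℕ → List ℕ → List ℕ × ℕ
remove m []       = [] , 0
remove m (a ∷ as) with a ℕ.≟ m
... | yes _ = as , 0
... | no  _ = a ∷ proj₁ (remove m as) , suc (proj₂ (remove m as))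

insertAt-↭ : ∀ k m σ → insertAt k m σ ↭ m ∷ σ
insertAt-↭ zero    m σ       = ↭.refl
insertAt-↭ (suc k) m []      = ↭.refl
insertAt-↭ (suc k) m (a ∷ σ) = ↭.trans (↭.prep a (insertAt-↭ k m σ)) (↭.swap a m ↭.refl)

remove-insertAt : ∀ k m σ → m ∉ σ → k ≤ length σ → remove m (insertAt k m σ) ≡ (σ , k)
remove-insertAt zero    m σ       m∉σ _ with m ℕ.≟ m
... | yes _   = refl
... | no  m≢m = ⊥-elim (m≢m refl)
remove-insertAt (suc k) m (a ∷ σ) m∉σ (s≤s k≤∣σ∣) with a ℕ.≟ m
... | yes refl = ⊥-elim (m∉σ (here refl))
... | no  _ rewrite remove-insertAt k m σ (m∉σ ∘ there) k≤∣σ∣ = refl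

insertAt-remove : ∀ m {π} → m ∈ π → insertAt (proj₂ (remove m π)) m (proj₁ (remove m π)) ≡ π
insertAt-remove m {a ∷ as} m∈ with a ℕ.≟ m | m∈
... | yes refl | _          = refl
... | no  a≢m  | here m≡a   = ⊥-elim (a≢m (sym m≡a))
... | no  _    | there m∈as = cong (a ∷_) (insertAt-remove m m∈as)

remove-index≤ : ∀ m {π} → m ∈ π → proj₂ (remove m π) ≤ length (proj₁ (remove m π))
remove-index≤ m {a ∷ as} m∈ with a ℕ.≟ m | m∈
... | yes refl | _          = z≤n
... | no  a≢m  | here m≡a   = ⊥-elim (a≢m (sym m≡a))
... | no  _    | there m∈as = s≤s (remove-index≤ m m∈as)

maxInsertion : ∀ m → InsertionBijection m
maxInsertion m = record
  { insert         = λ σ k → insertAt k m σ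
  ; extract        = remove m
  ; insert-↭       = λ σ k → insertAt-↭ k m σ
  ; extract-insert = λ σ k (length-σ , σ<m , _) k<1+m →
      remove-insertAt k m σ (All<⇒∉ σ σ<m) (subst (k ≤_) (sym length-σ) (ℕP.≤-pred k<1+m))
  ; extract-<      = λ π π-perm → s≤s (subst (proj₂ (remove m π) ≤_) (length-rest π-perm)
                                             (remove-index≤ m (IsPerm-suc⇒max∈ m π-perm)))
  ; insert-extract = λ π π-perm → insertAt-remove m (IsPerm-suc⇒max∈ m π-perm)
  }
  where
  length-rest : ∀ {π} → IsPerm (suc m) π → length (proj₁ (remove m π)) ≡ m
  length-rest {π} π-perm@(length-π , _) = ℕP.suc-injective (trans (sym (↭ₚ.↭-length π↭)) length-π)
    where
    π↭ : π ↭ m ∷ proj₁ (remove m π)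
    π↭ = subst (_↭ m ∷ proj₁ (remove m π)) (insertAt-remove m (IsPerm-suc⇒max∈ m π-perm)) (insertAt-↭ _ m _)

data Adjacency : Set where
  descent succession bigAscent equal : Adjacency

adjacency : ℕ → ℕ → Adjacency
adjacency a b with b ℕ.<? a
... | yes _ = descent
... | no  _ with b ℕ.≟ suc a
... | yes _ = succession
... | no  _ with suc (suc a) ℕ.≤? b
... | yes _ = bigAscent
... | no  _ = equal

adjacency-descent : ∀ {a b} → b < a → adjacency a b ≡ descent
adjacency-descent {a} {b} b<a with b ℕ.<? a
... | yes _   = refl
... | no  b≮a = ⊥-elim (b≮a b<a)

adjacency-succession : ∀ a → adjacency a (suc a) ≡ succession
adjacency-succession a with suc a ℕ.<? a
... | yes 1+a<a = ⊥-elim (ℕP.<-asym 1+a<a (ℕP.n<1+n a))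
... | no  _ with suc a ℕ.≟ suc a
... | yes _     = refl
... | no  ≢     = ⊥-elim (≢ refl)

adjacency-bigAscent : ∀ {a b} → suc (suc a) ≤ b → adjacency a b ≡ bigAscent
adjacency-bigAscent {a} {b} 2+a≤b with b ℕ.<? a
... | yes b<a = ⊥-elim (ℕP.<-asym b<a (ℕP.≤-trans (ℕP.n≤1+n _) 2+a≤b))
... | no  _ with b ℕ.≟ suc a
... | yes refl = ⊥-elim (ℕP.<-irrefl refl 2+a≤b)
... | no  _ with suc (suc a) ℕ.≤? b
... | yes _    = refl
... | no  2+a≰b = ⊥-elim (2+a≰b 2+a≤b)

adjacency-≢ : ∀ {a b} → a ≢ b → adjacency a b ≢ equal
adjacency-≢ {a} {b} a≢b with b ℕ.<? a
... | yes _ = λ ()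
... | no  b≮a with b ℕ.≟ suc a
... | yes _ = λ ()
... | no  b≢1+a with suc (suc a) ℕ.≤? b
... | yes _ = λ ()
... | no  2+a≰b = λ _ → a≢b (ℕP.≤-antisym (ℕP.≮⇒≥ b≮a) (ℕP.≮⇒≥ a≮b))
  where
  a≮b : ¬ a < b
  a≮b a<b with ℕP.m≤n⇒m<n∨m≡n a<b
  ... | inj₁ 1+a<b = 2+a≰b 1+a<b
  ... | inj₂ 1+a≡b = b≢1+a (sym 1+a≡b)

-- Adjacent letters of a permutation are never equal; the weight 1 of `equal` is a placeholder.
module AdjacencyWeight (R : CommRing) where
  open CommRing R

  weight : Adjacency → Carrier → Carrier → Carrier → Carrier
  weight descent    X Y Z = Y
  weight succession X Y Z = Z
  weight bigAscent  X Y Z = X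
  weight equal      X Y Z = 1#

  ∂weight : Adjacency → Carrier
  ∂weight equal = 0#
  ∂weight _     = 1#

  W ∂W : Carrier → Carrier → Carrier → List ℕ → Carrier
  W X Y Z []          = 1#
  W X Y Z (a ∷ [])    = 1#
  W X Y Z (a ∷ b ∷ r) = weight (adjacency a b) X Y Z * W X Y Z (b ∷ r)
  ∂W X Y Z []          = 0#
  ∂W X Y Z (a ∷ [])    = 0#
  ∂W X Y Z (a ∷ b ∷ r) = ∂weight (adjacency a b) * W X Y Z (b ∷ r)
                       + weight (adjacency a b) X Y Z * ∂W X Y Z (b ∷ r)

  ∂weight-≢ : ∀ {a b} → a ≢ b → ∂weight (adjacency a b) ≡ 1#
  ∂weight-≢ {a} {b} a≢b with adjacency a b | adjacency-≢ a≢b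
  ... | descent    | _  = refl
  ... | succession | _  = refl
  ... | bigAscent  | _  = refl
  ... | equal      | ≢e = ⊥-elim (≢e refl)

module AdjacencyWeightDual (R : CommRing) where
  open CommRing R
  open AdjacencyWeight R
  private module DW = AdjacencyWeight (Dual R)

  W-dual : ∀ X Y Z σ → DW.W (_+ε {R} X) (_+ε {R} Y) (_+ε {R} Z) σ ≡ (W X Y Z σ , ∂W X Y Z σ)
  W-dual X Y Z []          = refl
  W-dual X Y Z (a ∷ [])    = refl
  W-dual X Y Z (a ∷ b ∷ r) = trans
    (cong₂ (CommRing._*_ (Dual R)) (weight-dual (adjacency a b)) (W-dual X Y Z (b ∷ r)))
    (cong (weight (adjacency a b) X Y Z * W X Y Z (b ∷ r) ,_) (+-comm _ _))
    where
    weight-dual : ∀ t → DW.weight t (_+ε {R} X) (_+ε {R} Y) (_+ε {R} Z) ≡ (weight t X Y Z , ∂weight t)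
    weight-dual descent    = refl
    weight-dual succession = refl
    weight-dual bigAscent  = refl
    weight-dual equal      = refl

module MaxInsertionSum (R : CommRing) (X Y Z : CommRing.Carrier R) where
  open CommRing R
  open CommRingProperties R
  open Sums R
  open AdjacencyWeight R hiding (W; ∂W)
  open ≡-Reasoning

  W ∂W : List ℕ → Carrier
  W  = AdjacencyWeight.W R X Y Z
  ∂W = AdjacencyWeight.∂W R X Y Z

  wt : ℕ → ℕ → Carrier
  wt a b = weight (adjacency a b) X Y Z

  wt-bigAscent : ∀ {a b} → suc (suc a) ≤ b → wt a b ≡ X
  wt-bigAscent 2+a≤b = cong (λ t → weight t X Y Z) (adjacency-bigAscent 2+a≤b)

  wt-descent : ∀ {a b} → b < a → wt a b ≡ Y
  wt-descent b<a = cong (λ t → weight t X Y Z) (adjacency-descent b<a)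

  wt-succession : ∀ a → wt a (suc a) ≡ Z
  wt-succession a = cong (λ t → weight t X Y Z) (adjacency-succession a)

  insertAfter : ℕ → ℕ → List ℕ → Carrier
  insertAfter m a ρ = ∑< (suc (length ρ)) (λ k → W (a ∷ insertAt k m ρ))

  insertAfter-∷ : ∀ m a b ρ → insertAfter m a (b ∷ ρ)
                              ≡ wt a m * (wt m b * W (b ∷ ρ)) + wt a b * insertAfter m b ρ
  insertAfter-∷ m a b ρ = cong (_+_ (wt a m * (wt m b * W (b ∷ ρ))))
                               (∑<-*ˡ (suc (length ρ)) (wt a b) (λ k → W (b ∷ insertAt k m ρ)))

  -- Inserting m between a and b turns the pair (a, b) into the big ascent (a, m) and the descent (m, b).
  insertAfter-large : ∀ m a ρ → All (λ x → suc (suc x) ≤ m) (a ∷ ρ) → Unique (a ∷ ρ) →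
                      insertAfter m a ρ ≡ X * W (a ∷ ρ) + X * Y * ∂W (a ∷ ρ)
  insertAfter-large m a []      (2+a≤m ∷ []) _ = trans (cong (λ t → t * 1# + 0#) (wt-bigAscent 2+a≤m))
    (solve 2 (λ X Y → X :* con (+ 1) :+ con (+ 0) := X :* con (+ 1) :+ X :* Y :* con (+ 0)) refl X Y)
  insertAfter-large m a (b ∷ ρ) (2+a≤m ∷ ρ-small@(2+b≤m ∷ _)) ((a≢b ∷ _) ∷ !bρ) = begin
    insertAfter m a (b ∷ ρ)
      ≡⟨ insertAfter-∷ m a b ρ ⟩
    wt a m * (wt m b * W (b ∷ ρ)) + wt a b * insertAfter m b ρ
      ≡⟨ cong₂ (λ p q → p * (q * W (b ∷ ρ)) + wt a b * insertAfter m b ρ)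
               (wt-bigAscent 2+a≤m) (wt-descent (ℕP.≤-trans (ℕP.n≤1+n _) 2+b≤m)) ⟩
    X * (Y * W (b ∷ ρ)) + wt a b * insertAfter m b ρ
      ≡⟨ cong (λ t → X * (Y * W (b ∷ ρ)) + wt a b * t) (insertAfter-large m b ρ ρ-small !bρ) ⟩
    X * (Y * W (b ∷ ρ)) + wt a b * (X * W (b ∷ ρ) + X * Y * ∂W (b ∷ ρ))
      ≡⟨ solve 5 (λ X Y w s d → X :* (Y :* w) :+ s :* (X :* w :+ X :* Y :* d)
                                := X :* (s :* w) :+ X :* Y :* (con (+ 1) :* w :+ s :* d))
               refl X Y (W (b ∷ ρ)) (wt a b) (∂W (b ∷ ρ)) ⟩
    X * (wt a b * W (b ∷ ρ)) + X * Y * (1# * W (b ∷ ρ) + wt a b * ∂W (b ∷ ρ))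
      ≡⟨ cong (λ t → X * (wt a b * W (b ∷ ρ)) + X * Y * (t * W (b ∷ ρ) + wt a b * ∂W (b ∷ ρ)))
              (∂weight-≢ a≢b) ⟨
    X * W (a ∷ b ∷ ρ) + X * Y * ∂W (a ∷ b ∷ ρ) ∎

  insertAfter-top : ∀ q ρ → All (_< q) ρ → Unique (q ∷ ρ) →
                    insertAfter (suc q) q ρ ≡ Z * W (q ∷ ρ) + X * Y * ∂W (q ∷ ρ)
  insertAfter-top q []      _ _ = trans (cong (λ t → t * 1# + 0#) (wt-succession q))
    (solve 3 (λ X Y Z → Z :* con (+ 1) :+ con (+ 0) := Z :* con (+ 1) :+ X :* Y :* con (+ 0)) refl X Y Z)
  insertAfter-top q (b ∷ ρ) bρ<q@(b<q ∷ _) ((q≢b ∷ _) ∷ !bρ) = begin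
    insertAfter (suc q) q (b ∷ ρ)
      ≡⟨ insertAfter-∷ (suc q) q b ρ ⟩
    wt q (suc q) * (wt (suc q) b * W (b ∷ ρ)) + wt q b * insertAfter (suc q) b ρ
      ≡⟨ cong₂ (λ s t → s * (t * W (b ∷ ρ)) + wt q b * insertAfter (suc q) b ρ)
               (wt-succession q) (wt-descent (ℕP.m<n⇒m<1+n b<q)) ⟩
    Z * (Y * W (b ∷ ρ)) + wt q b * insertAfter (suc q) b ρ
      ≡⟨ cong₂ (λ p t → Z * (Y * W (b ∷ ρ)) + p * t)
               (wt-descent b<q) (insertAfter-large (suc q) b ρ (All.map s≤s bρ<q) !bρ) ⟩
    Z * (Y * W (b ∷ ρ)) + Y * (X * W (b ∷ ρ) + X * Y * ∂W (b ∷ ρ))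
      ≡⟨ solve 5 (λ X Y Z w d → Z :* (Y :* w) :+ Y :* (X :* w :+ X :* Y :* d)
                                := Z :* (Y :* w) :+ X :* Y :* (con (+ 1) :* w :+ Y :* d))
               refl X Y Z (W (b ∷ ρ)) (∂W (b ∷ ρ)) ⟩
    Z * (Y * W (b ∷ ρ)) + X * Y * (1# * W (b ∷ ρ) + Y * ∂W (b ∷ ρ))
      ≡⟨ cong₂ (λ p t → Z * (p * W (b ∷ ρ)) + X * Y * (t * W (b ∷ ρ) + p * ∂W (b ∷ ρ)))
               (wt-descent b<q) (∂weight-≢ q≢b) ⟨
    Z * W (q ∷ b ∷ ρ) + X * Y * ∂W (q ∷ b ∷ ρ) ∎

  insertAfter-succ : ∀ q a ρ → q ∈ a ∷ ρ → All (_< suc q) (a ∷ ρ) → Unique (a ∷ ρ) →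
                     insertAfter (suc q) a ρ ≡ Z * W (a ∷ ρ) + X * Y * ∂W (a ∷ ρ)
  insertAfter-succ q a ρ q∈ (a<1+q ∷ ρ<1+q) !aρ@(a∉ρ ∷ _) with a ℕ.≟ q
  ... | yes refl = insertAfter-top a ρ (All<-suc-∉ ρ ρ<1+q (All¬⇒¬Any a∉ρ)) !aρ
  insertAfter-succ q a ρ (here q≡a) _ _ | no a≢q = ⊥-elim (a≢q (sym q≡a))
  insertAfter-succ q a (b ∷ ρ) (there q∈bρ) (a<1+q ∷ bρ<1+q@(b<1+q ∷ _)) ((a≢b ∷ _) ∷ !bρ) | no a≢q = begin
    insertAfter (suc q) a (b ∷ ρ)
      ≡⟨ insertAfter-∷ (suc q) a b ρ ⟩
    wt a (suc q) * (wt (suc q) b * W (b ∷ ρ)) + wt a b * insertAfter (suc q) b ρ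
      ≡⟨ cong₂ (λ p t → p * (t * W (b ∷ ρ)) + wt a b * insertAfter (suc q) b ρ)
               (wt-bigAscent (s≤s (ℕP.≤∧≢⇒< (ℕP.≤-pred a<1+q) a≢q))) (wt-descent b<1+q) ⟩
    X * (Y * W (b ∷ ρ)) + wt a b * insertAfter (suc q) b ρ
      ≡⟨ cong (λ t → X * (Y * W (b ∷ ρ)) + wt a b * t) (insertAfter-succ q b ρ q∈bρ bρ<1+q !bρ) ⟩
    X * (Y * W (b ∷ ρ)) + wt a b * (Z * W (b ∷ ρ) + X * Y * ∂W (b ∷ ρ))
      ≡⟨ solve 6 (λ X Y Z w s d → X :* (Y :* w) :+ s :* (Z :* w :+ X :* Y :* d)
                                  := Z :* (s :* w) :+ X :* Y :* (con (+ 1) :* w :+ s :* d))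
               refl X Y Z (W (b ∷ ρ)) (wt a b) (∂W (b ∷ ρ)) ⟩
    Z * (wt a b * W (b ∷ ρ)) + X * Y * (1# * W (b ∷ ρ) + wt a b * ∂W (b ∷ ρ))
      ≡⟨ cong (λ t → Z * (wt a b * W (b ∷ ρ)) + X * Y * (t * W (b ∷ ρ) + wt a b * ∂W (b ∷ ρ)))
              (∂weight-≢ a≢b) ⟨
    Z * W (a ∷ b ∷ ρ) + X * Y * ∂W (a ∷ b ∷ ρ) ∎

  ∑-insertAt-max : ∀ q σ → IsPerm (suc q) σ →
                   ∑< (suc (suc q)) (λ k → W (insertAt k (suc q) σ)) ≡ (Y + Z) * W σ + X * Y * ∂W σ
  ∑-insertAt-max q (a ∷ ρ) σ-perm@(length-σ , σ<1+q@(a<1+q ∷ _) , !σ) = begin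
    W (suc q ∷ a ∷ ρ) + ∑< (suc q) (λ k → W (a ∷ insertAt k (suc q) ρ))
      ≡⟨ cong₂ _+_ (cong (_* W (a ∷ ρ)) (wt-descent a<1+q))
                   (cong (λ l → ∑< (suc l) (λ k → W (a ∷ insertAt k (suc q) ρ)))
                         (sym (ℕP.suc-injective length-σ))) ⟩
    Y * W (a ∷ ρ) + insertAfter (suc q) a ρ
      ≡⟨ cong (λ t → Y * W (a ∷ ρ) + t) (insertAfter-succ q a ρ (IsPerm-suc⇒max∈ q σ-perm) σ<1+q !σ) ⟩
    Y * W (a ∷ ρ) + (Z * W (a ∷ ρ) + X * Y * ∂W (a ∷ ρ))
      ≡⟨ solve 5 (λ X Y Z w d → Y :* w :+ (Z :* w :+ X :* Y :* d) := (Y :+ Z) :* w :+ X :* Y :* d)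
               refl X Y Z (W (a ∷ ρ)) (∂W (a ∷ ρ)) ⟩
    (Y + Z) * W (a ∷ ρ) + X * Y * ∂W (a ∷ ρ) ∎

P : ℕ → Poly₃
P n R X Y Z = Sums.∑ R (Perm (suc n)) (AdjacencyWeight.W R X Y Z)

P-recurrence : Recurrence (λ R X Y Z → CommRing._+_ R Y Z) P
P-recurrence n R X Y Z = begin
  ∑ (Perm (suc (suc n))) W
    ≡⟨ ∑-Perm-suc (maxInsertion (suc n)) W ⟩
  ∑ (Perm (suc n)) (λ σ → ∑< (suc (suc n)) (λ k → W (insertAt k (suc n) σ)))
    ≡⟨ ∑-cong (Perm (suc n)) (λ σ σ∈ → ∑-insertAt-max n σ (∈-Perm⁻ (suc n) σ∈)) ⟩
  ∑ (Perm (suc n)) (λ σ → (Y + Z) * W σ + X * Y * ∂W σ)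
    ≡⟨ trans (∑-+ (Perm (suc n)) _ _)
             (cong₂ _+_ (∑-*ˡ (Perm (suc n)) (Y + Z) W) (∑-*ˡ (Perm (suc n)) (X * Y) ∂W)) ⟩
  (Y + Z) * P n R X Y Z + X * Y * ∑ (Perm (suc n)) ∂W
    ≡⟨ cong (λ d → (Y + Z) * P n R X Y Z + X * Y * d) ∂P ⟨
  (Y + Z) * P n R X Y Z + X * Y * ∂ (P n) R X Y Z ∎
  where
  open CommRing R
  open Sums R
  open PermSums R
  open MaxInsertionSum R X Y Z
  open ≡-Reasoning
  ∂P : ∂ (P n) R X Y Z ≡ ∑ (Perm (suc n)) ∂W
  ∂P = trans (cong proj₂ (DualProperties.∑-dual R (Perm (suc n)) _))
             (∑-cong (Perm (suc n)) (λ σ _ → cong proj₂ (AdjacencyWeightDual.W-dual R X Y Z σ)))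

P≡Q : ∀ n R X Y Z → P n R X Y Z ≡ Q n R X Y Z
P≡Q = recurrence-determined P Q P-recurrence Q-recurrence
  (λ R X Y Z → let open CommRingProperties R in
     solve 0 (con (+ 1) :+ con (+ 0)
              := con (+ 1) :* (con (+ 1) :* (con (+ 1) :* con (+ 1))) :+ con (+ 0) :+ con (+ 0)) refl)

-- The first identity

[_]₀₁ : Bool.Bool → ℕ
[ b ]₀₁ = if b then 1 else 0

weight-ℤ : ∀ (x y z : ℤ) a b →
  x ℤ.^ [ ⌊ suc (suc a) ℕ.≤? b ⌋ ]₀₁ ℤ.* y ℤ.^ [ ⌊ b ℕ.<? a ⌋ ]₀₁ ℤ.* z ℤ.^ [ ⌊ b ℕ.≟ suc a ⌋ ]₀₁
  ≡ AdjacencyWeight.weight ℤ-ring (adjacency a b) x y z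
weight-ℤ x y z a b with b ℕ.<? a
... | yes b<a with b ℕ.≟ suc a | suc (suc a) ℕ.≤? b
...   | yes refl | _          = ⊥-elim (ℕP.<-asym b<a (ℕP.n<1+n a))
...   | no  _    | yes 2+a≤b  = ⊥-elim (ℕP.<-asym b<a (ℕP.≤-trans (ℕP.n≤1+n _) 2+a≤b))
...   | no  _    | no  _      = only-y
  where
  only-y : x ℤ.^ 0 ℤ.* y ℤ.^ 1 ℤ.* z ℤ.^ 0 ≡ y
  only-y = trans (ℤP.*-identityʳ _) (trans (ℤP.*-identityˡ _) (ℤP.*-identityʳ y))
weight-ℤ x y z a b | no _ with b ℕ.≟ suc a
... | yes refl with suc (suc a) ℕ.≤? suc a
...   | yes 2+a≤1+a = ⊥-elim (ℕP.<-irrefl refl 2+a≤1+a)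
...   | no  _       = only-z
  where
  only-z : x ℤ.^ 0 ℤ.* y ℤ.^ 0 ℤ.* z ℤ.^ 1 ≡ z
  only-z = trans (ℤP.*-identityˡ _) (ℤP.*-identityʳ z)
weight-ℤ x y z a b | no _ | no _ with suc (suc a) ℕ.≤? b
... | yes _ = only-x
  where
  only-x : x ℤ.^ 1 ℤ.* y ℤ.^ 0 ℤ.* z ℤ.^ 0 ≡ x
  only-x = trans (ℤP.*-identityʳ _) (trans (ℤP.*-identityʳ _) (ℤP.*-identityʳ x))
... | no  _ = refl

W-ℤ : ∀ (x y z : ℤ) π →
      x ℤ.^ basc π ℤ.* y ℤ.^ des π ℤ.* z ℤ.^ sucs π ≡ AdjacencyWeight.W ℤ-ring x y z π
W-ℤ x y z []          = refl
W-ℤ x y z (a ∷ [])    = refl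
W-ℤ x y z (a ∷ b ∷ r) = begin
  x ℤ.^ (i ℕ.+ basc (b ∷ r)) ℤ.* y ℤ.^ (j ℕ.+ des (b ∷ r)) ℤ.* z ℤ.^ (k ℕ.+ sucs (b ∷ r))
    ≡⟨ cong₂ ℤ._*_ (cong₂ ℤ._*_ (ℤP.^-distribˡ-+-* x i _) (ℤP.^-distribˡ-+-* y j _))
                   (ℤP.^-distribˡ-+-* z k _) ⟩
  (x ℤ.^ i ℤ.* x ℤ.^ basc (b ∷ r)) ℤ.* (y ℤ.^ j ℤ.* y ℤ.^ des (b ∷ r)) ℤ.* (z ℤ.^ k ℤ.* z ℤ.^ sucs (b ∷ r))
    ≡⟨ regroup (x ℤ.^ i) (x ℤ.^ basc (b ∷ r)) (y ℤ.^ j) (y ℤ.^ des (b ∷ r)) (z ℤ.^ k) (z ℤ.^ sucs (b ∷ r)) ⟩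
  (x ℤ.^ i ℤ.* y ℤ.^ j ℤ.* z ℤ.^ k) ℤ.* (x ℤ.^ basc (b ∷ r) ℤ.* y ℤ.^ des (b ∷ r) ℤ.* z ℤ.^ sucs (b ∷ r))
    ≡⟨ cong₂ ℤ._*_ (weight-ℤ x y z a b) (W-ℤ x y z (b ∷ r)) ⟩
  AdjacencyWeight.W ℤ-ring x y z (a ∷ b ∷ r) ∎
  where
  open ≡-Reasoning
  i = [ ⌊ suc (suc a) ℕ.≤? b ⌋ ]₀₁
  j = [ ⌊ b ℕ.<? a ⌋ ]₀₁
  k = [ ⌊ b ℕ.≟ suc a ⌋ ]₀₁
  regroup : ∀ (a b c d e f : ℤ) →
            (a ℤ.* b) ℤ.* (c ℤ.* d) ℤ.* (e ℤ.* f) ≡ (a ℤ.* c ℤ.* e) ℤ.* (b ℤ.* d ℤ.* f)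
  regroup = ℤ-Solver.solve-∀

^-ℤ : ∀ (x : ℤ) k → CommRing._^_ ℤ-ring x k ≡ x ℤ.^ k
^-ℤ x zero    = refl
^-ℤ x (suc k) = cong (x ℤ.*_) (^-ℤ x k)

n<2j : ∀ n j → suc (n / 2) ≤ j → n < 2 ℕ.* j
n<2j n j 1+n/2≤j = begin-strict
  n                         ≡⟨ m≡m%n+[m/n]*n n 2 ⟩
  n % 2 ℕ.+ (n / 2) ℕ.* 2   <⟨ ℕP.+-monoˡ-< ((n / 2) ℕ.* 2) (m%n<n n 2) ⟩
  suc (n / 2) ℕ.* 2         ≤⟨ ℕP.*-monoˡ-≤ 2 1+n/2≤j ⟩
  j ℕ.* 2                   ≡⟨ ℕP.*-comm j 2 ⟩
  2 ℕ.* j                   ∎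
  where open ℕP.≤-Reasoning

Q-at-Z≡-Y : ∀ n (x y : ℤ) → Q n ℤ-ring x y (ℤ.- y) ≡ RHS₁ n x y
Q-at-Z≡-Y n x y = begin
  G n u v (y ℤ.+ ℤ.- y)
    ≡⟨ cong (G n u v) (ℤP.+-inverseʳ y) ⟩
  G n u v (+ 0)
    ≡⟨ cong (ℤ._+_ (∑< (suc n) f₀))
            (∑<-zero n _ (λ i _ → ∑<-zero (suc n) _ (λ j _ → w-positive i j))) ⟩
  ∑< (suc n) f₀ ℤ.+ + 0
    ≡⟨ ℤP.+-identityʳ _ ⟩
  ∑< (suc n) f₀
    ≡⟨ ∑<-vanishing-tail f₀ (s≤s (m/n≤m n 2))
         (λ j 1+n/2≤j → cong (ℤ._* (u ^ j ℤ.* (v ^ e n 0 j ℤ.* + 1)))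
                             (γ-vanishes n 0 j (n<2j n j 1+n/2≤j))) ⟩
  ∑< (suc (n / 2)) f₀
    ≡⟨ ∑<-cong (suc (n / 2)) (λ j _ → summand j) ⟩
  ∑< (suc (n / 2)) (λ j → γ n 0 j ℤ.* u ℤ.^ j ℤ.* v ℤ.^ (n ∸ 2 ℕ.* j))
    ≡⟨ ∑-upTo (suc (n / 2)) (λ j → γ n 0 j ℤ.* u ℤ.^ j ℤ.* v ℤ.^ (n ∸ 2 ℕ.* j)) ⟨
  RHS₁ n x y ∎
  where
  open ≡-Reasoning
  open CommRing ℤ-ring using (_^_)
  open Sums ℤ-ring
  open GammaPolynomial ℤ-ring
  u = + 2 ℤ.* x ℤ.* y
  v = x ℤ.+ y
  f₀ : ℕ → ℤ
  f₀ j = γ n 0 j ℤ.* (u ^ j ℤ.* (v ^ e n 0 j ℤ.* + 1))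
  w-positive : ∀ i j → γ n (suc i) j ℤ.* (u ^ j ℤ.* (v ^ e n (suc i) j ℤ.* (+ 0 ℤ.* (+ 0) ^ i))) ≡ + 0
  w-positive i j = trans (cong (λ t → γ n (suc i) j ℤ.* (u ^ j ℤ.* t)) (ℤP.*-zeroʳ (v ^ e n (suc i) j)))
                         (trans (cong (γ n (suc i) j ℤ.*_) (ℤP.*-zeroʳ (u ^ j))) (ℤP.*-zeroʳ (γ n (suc i) j)))
  summand : ∀ j → f₀ j ≡ γ n 0 j ℤ.* u ℤ.^ j ℤ.* v ℤ.^ (n ∸ 2 ℕ.* j)
  summand j = trans (cong (λ t → γ n 0 j ℤ.* (u ^ j ℤ.* t)) (ℤP.*-identityʳ _))
                    (trans (sym (ℤP.*-assoc (γ n 0 j) _ _))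
                           (cong₂ (λ p q → γ n 0 j ℤ.* p ℤ.* q) (^-ℤ u j) (^-ℤ v (e n 0 j))))

first-identity : ∀ n (x y : ℤ) → LHS₁ n x y ≡ RHS₁ n x y
first-identity n x y = begin
  LHS₁ n x y             ≡⟨ Sums.∑-cong ℤ-ring (Perm (suc n)) (λ π _ → W-ℤ x y (ℤ.- y) π) ⟩
  P n ℤ-ring x y (ℤ.- y) ≡⟨ P≡Q n ℤ-ring x y (ℤ.- y) ⟩
  Q n ℤ-ring x y (ℤ.- y) ≡⟨ Q-at-Z≡-Y n x y ⟩
  RHS₁ n x y             ∎
  where open ≡-Reasoning

-- Inserting the largest letter into a cycle

replaceAt : ℕ → ℕ → List ℕ → List ℕ × ℕ
replaceAt i       n []       = [] , n
replaceAt zero    n (a ∷ as) = n ∷ as , a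
replaceAt (suc i) n (a ∷ as) = a ∷ proj₁ (replaceAt i n as) , proj₂ (replaceAt i n as)

-- Sets π(i) := n and π(n) := π(i), i.e. inserts n after i in its cycle; for i = n, n becomes a fixed point.
insertInCycle : ℕ → ℕ → List ℕ → List ℕ
insertInCycle n i π = proj₁ (replaceAt i n π) ++ [ proj₂ (replaceAt i n π) ]

replaceValue : ℕ → ℕ → List ℕ → List ℕ × ℕ
replaceValue n l []       = [] , 0
replaceValue n l (a ∷ as) with a ℕ.≟ n
... | yes _ = l ∷ as , 0
... | no  _ = a ∷ proj₁ (replaceValue n l as) , suc (proj₂ (replaceValue n l as))

splitLast : List ℕ → List ℕ × ℕ
splitLast []          = [] , 0
splitLast (a ∷ [])    = [] , a
splitLast (a ∷ b ∷ r) = a ∷ proj₁ (splitLast (b ∷ r)) , proj₂ (splitLast (b ∷ r))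

removeFromCycle : ℕ → List ℕ → List ℕ × ℕ
removeFromCycle n π = replaceValue n (proj₂ (splitLast π)) (proj₁ (splitLast π))

splitLast-∷ʳ : ∀ xs y → splitLast (xs ++ [ y ]) ≡ (xs , y)
splitLast-∷ʳ []          y = refl
splitLast-∷ʳ (a ∷ [])    y = refl
splitLast-∷ʳ (a ∷ b ∷ r) y rewrite splitLast-∷ʳ (b ∷ r) y = refl

splitLast-++ : ∀ a r → proj₁ (splitLast (a ∷ r)) ++ [ proj₂ (splitLast (a ∷ r)) ] ≡ a ∷ r
splitLast-++ a []      = refl
splitLast-++ a (b ∷ r) = cong (a ∷_) (splitLast-++ b r)

replaceAt-length : ∀ i n π → length (proj₁ (replaceAt i n π)) ≡ length π
replaceAt-length i       n []       = refl
replaceAt-length zero    n (a ∷ as) = refl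
replaceAt-length (suc i) n (a ∷ as) = cong suc (replaceAt-length i n as)

replaceAt-length-π : ∀ n π → replaceAt (length π) n π ≡ (π , n)
replaceAt-length-π n []       = refl
replaceAt-length-π n (a ∷ as) rewrite replaceAt-length-π n as = refl

insertInCycle-↭ : ∀ n i π → insertInCycle n i π ↭ n ∷ π
insertInCycle-↭ n i       []       = ↭.refl
insertInCycle-↭ n zero    (a ∷ as) = ↭.prep n (↭ₚ.++-comm as [ a ])
insertInCycle-↭ n (suc i) (a ∷ as) = ↭.trans (↭.prep a (insertInCycle-↭ n i as)) (↭.swap a n ↭.refl)

replaceValue-replaceAt : ∀ n π i → n ∉ π → i ≤ length π →
                         replaceValue n (proj₂ (replaceAt i n π)) (proj₁ (replaceAt i n π)) ≡ (π , i)
replaceValue-replaceAt n []       zero    _   _ = refl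
replaceValue-replaceAt n (a ∷ as) zero    _   _ with n ℕ.≟ n
... | yes _   = refl
... | no  n≢n = ⊥-elim (n≢n refl)
replaceValue-replaceAt n (a ∷ as) (suc i) n∉ (s≤s i≤∣as∣) with a ℕ.≟ n
... | yes refl = ⊥-elim (n∉ (here refl))
... | no  _ rewrite replaceValue-replaceAt n as i (n∉ ∘ there) i≤∣as∣ = refl

replaceAt-replaceValue : ∀ n l ini → n ∈ ini ⊎ l ≡ n →
                         replaceAt (proj₂ (replaceValue n l ini)) n (proj₁ (replaceValue n l ini)) ≡ (ini , l)
replaceAt-replaceValue n l []       (inj₂ refl) = refl
replaceAt-replaceValue n l (a ∷ as) n∈⊎l≡n with a ℕ.≟ n | n∈⊎l≡n
... | yes refl | _                 = refl
... | no  a≢n  | inj₁ (here n≡a)   = ⊥-elim (a≢n (sym n≡a))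
... | no  _    | inj₁ (there n∈as) rewrite replaceAt-replaceValue n l as (inj₁ n∈as) = refl
... | no  _    | inj₂ l≡n          rewrite replaceAt-replaceValue n l as (inj₂ l≡n) = refl

replaceValue-index≤ : ∀ n l ini → proj₂ (replaceValue n l ini) ≤ length ini
replaceValue-index≤ n l []       = z≤n
replaceValue-index≤ n l (a ∷ as) with a ℕ.≟ n
... | yes _ = z≤n
... | no  _ = s≤s (replaceValue-index≤ n l as)

insertInCycle-removeFromCycle : ∀ n {a r} → IsPerm (suc n) (a ∷ r) →
  let (σ , i) = removeFromCycle n (a ∷ r) in insertInCycle n i σ ≡ a ∷ r
insertInCycle-removeFromCycle n {a} {r} π-perm =
  trans (cong (λ p → proj₁ p ++ [ proj₂ p ]) (replaceAt-replaceValue n lst ini n∈ini⊎lst≡n)) (splitLast-++ a r)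
  where
  ini = proj₁ (splitLast (a ∷ r))
  lst = proj₂ (splitLast (a ∷ r))
  n∈ini⊎lst≡n : n ∈ ini ⊎ lst ≡ n
  n∈ini⊎lst≡n with lst ℕ.≟ n | ∈-++⁻ ini (subst (n ∈_) (sym (splitLast-++ a r)) (IsPerm-suc⇒max∈ n π-perm))
  ... | yes lst≡n | _                = inj₂ lst≡n
  ... | no  _     | inj₁ n∈ini       = inj₁ n∈ini
  ... | no  lst≢n | inj₂ (here n≡lst) = ⊥-elim (lst≢n (sym n≡lst))

removeFromCycle-index< : ∀ n {a r} → IsPerm (suc n) (a ∷ r) → proj₂ (removeFromCycle n (a ∷ r)) < suc n
removeFromCycle-index< n {a} {r} (length-π , _) =
  s≤s (subst (proj₂ (removeFromCycle n (a ∷ r)) ≤_) length-ini (replaceValue-index≤ n _ ini))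
  where
  ini = proj₁ (splitLast (a ∷ r))
  length-ini : length ini ≡ n
  length-ini = ℕP.suc-injective (begin
    suc (length ini)                                ≡⟨ ℕP.+-comm 1 (length ini) ⟩
    length ini ℕ.+ 1                                ≡⟨ length-++ ini ⟨
    length (ini ++ [ proj₂ (splitLast (a ∷ r)) ])  ≡⟨ cong length (splitLast-++ a r) ⟩
    length (a ∷ r)                                  ≡⟨ length-π ⟩
    suc n                                           ∎)
    where open ≡-Reasoning

cycleInsertion : ∀ n → InsertionBijection n
cycleInsertion n = record
  { insert         = λ π i → insertInCycle n i π
  ; extract        = removeFromCycle n
  ; insert-↭       = λ π i → insertInCycle-↭ n i π
  ; extract-insert = λ π i (length-π , π<n , _) i<1+n →
      trans (cong (uncurry (replaceValue n) ∘ swap)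
                  (splitLast-∷ʳ (proj₁ (replaceAt i n π)) (proj₂ (replaceAt i n π))))
            (replaceValue-replaceAt n π i (All<⇒∉ π π<n) (subst (i ≤_) (sym length-π) (ℕP.≤-pred i<1+n)))
  ; extract-<      = λ { (a ∷ r) π-perm → removeFromCycle-index< n π-perm }
  ; insert-extract = λ { (a ∷ r) π-perm → insertInCycle-removeFromCycle n π-perm }
  }

data PositionType : Set where
  excedance fixedPoint drop : PositionType

positionType : ℕ → ℕ → PositionType
positionType p a with p ℕ.<? a
... | yes _ = excedance
... | no  _ with p ℕ.≟ a
... | yes _ = fixedPoint
... | no  _ = drop

positionType-excedance : ∀ {p a} → p < a → positionType p a ≡ excedance
positionType-excedance {p} {a} p<a with p ℕ.<? a
... | yes _   = refl
... | no  p≮a = ⊥-elim (p≮a p<a)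

positionType-fixedPoint : ∀ p → positionType p p ≡ fixedPoint
positionType-fixedPoint p with p ℕ.<? p
... | yes p<p = ⊥-elim (ℕP.<-irrefl refl p<p)
... | no  _ with p ℕ.≟ p
... | yes _   = refl
... | no  p≢p = ⊥-elim (p≢p refl)

positionType-drop : ∀ {p a} → a < p → positionType p a ≡ drop
positionType-drop {p} {a} a<p with p ℕ.<? a
... | yes p<a = ⊥-elim (ℕP.<-asym a<p p<a)
... | no  _ with p ℕ.≟ a
... | yes refl = ⊥-elim (ℕP.<-irrefl refl a<p)
... | no  _    = refl

-- V p π is the weight X^exc Y^drop Z^fix of π read as a map from {p, p + 1, …}.
module ExcedanceWeight (R : CommRing) where
  open CommRing R

  weight : PositionType → Carrier → Carrier → Carrier → Carrier
  weight excedance  X Y Z = X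
  weight fixedPoint X Y Z = Z
  weight drop       X Y Z = Y

  V ∂V : Carrier → Carrier → Carrier → ℕ → List ℕ → Carrier
  V X Y Z p []       = 1#
  V X Y Z p (a ∷ as) = weight (positionType p a) X Y Z * V X Y Z (suc p) as
  ∂V X Y Z p []       = 0#
  ∂V X Y Z p (a ∷ as) = weight (positionType p a) X Y Z * ∂V X Y Z (suc p) as + 1# * V X Y Z (suc p) as

module ExcedanceWeightDual (R : CommRing) where
  open CommRing R
  open ExcedanceWeight R
  private module DV = ExcedanceWeight (Dual R)

  V-dual : ∀ X Y Z p π → DV.V (_+ε {R} X) (_+ε {R} Y) (_+ε {R} Z) p π ≡ (V X Y Z p π , ∂V X Y Z p π)
  V-dual X Y Z p []       = refl
  V-dual X Y Z p (a ∷ as) = cong₂ (CommRing._*_ (Dual R)) (weight-dual (positionType p a)) (V-dual X Y Z (suc p) as)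
    where
    weight-dual : ∀ t → DV.weight t (_+ε {R} X) (_+ε {R} Y) (_+ε {R} Z) ≡ (weight t X Y Z , 1#)
    weight-dual excedance  = refl
    weight-dual fixedPoint = refl
    weight-dual drop       = refl

module CycleInsertionSum (R : CommRing) (X Y Z : CommRing.Carrier R) where
  open CommRing R
  open CommRingProperties R
  open Sums R
  open ExcedanceWeight R hiding (V; ∂V)
  open ≡-Reasoning

  V ∂V : ℕ → List ℕ → Carrier
  V  = ExcedanceWeight.V R X Y Z
  ∂V = ExcedanceWeight.∂V R X Y Z

  wt : ℕ → ℕ → Carrier
  wt p a = weight (positionType p a) X Y Z

  V-∷ʳ : ∀ p xs y → V p (xs ++ [ y ]) ≡ V p xs * wt (p ℕ.+ length xs) y
  V-∷ʳ p []       y = trans (cong (λ q → wt q y * 1#) (sym (ℕP.+-identityʳ p))) (*-comm _ _)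
  V-∷ʳ p (a ∷ xs) y = trans
    (cong (wt p a *_) (trans (V-∷ʳ (suc p) xs y)
                             (cong (λ q → V (suc p) xs * wt q y) (sym (ℕP.+-suc p (length xs))))))
    (sym (*-assoc _ _ _))

  -- Replacing the letter a < n at position i < n by n creates an excedance at i and a drop at n.
  ∑-replaceAt : ∀ n p π → All (_< n) π → p ℕ.+ length π ≡ n →
                ∑< (length π) (λ i → V p (proj₁ (replaceAt i n π)) * wt n (proj₂ (replaceAt i n π)))
                ≡ X * Y * ∂V p π
  ∑-replaceAt n p []       _              _ = solve 2 (λ X Y → con (+ 0) := X :* Y :* con (+ 0)) refl X Y
  ∑-replaceAt n p (a ∷ as) (a<n ∷ as<n) p+∣aas∣≡n = begin
    wt p n * V (suc p) as * wt n a + ∑< (length as) (λ i → wt p a * V (suc p) (proj₁ (r i)) * wt n (proj₂ (r i)))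
      ≡⟨ cong₂ (λ s t → s * V (suc p) as * t
                         + ∑< (length as) (λ i → wt p a * V (suc p) (proj₁ (r i)) * wt n (proj₂ (r i))))
               (cong (λ t → weight t X Y Z) (positionType-excedance p<n))
               (cong (λ t → weight t X Y Z) (positionType-drop a<n)) ⟩
    X * V (suc p) as * Y + ∑< (length as) (λ i → wt p a * V (suc p) (proj₁ (r i)) * wt n (proj₂ (r i)))
      ≡⟨ cong (_+_ (X * V (suc p) as * Y)) (trans (∑<-cong (length as) (λ i _ → *-assoc _ _ _))
                                                   (∑<-*ˡ (length as) (wt p a) _)) ⟩
    X * V (suc p) as * Y + wt p a * ∑< (length as) (λ i → V (suc p) (proj₁ (r i)) * wt n (proj₂ (r i)))
      ≡⟨ cong (λ t → X * V (suc p) as * Y + wt p a * t)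
              (∑-replaceAt n (suc p) as as<n (trans (sym (ℕP.+-suc p (length as))) p+∣aas∣≡n)) ⟩
    X * V (suc p) as * Y + wt p a * (X * Y * ∂V (suc p) as)
      ≡⟨ solve 5 (λ X Y v s d → X :* v :* Y :+ s :* (X :* Y :* d) := X :* Y :* (s :* d :+ con (+ 1) :* v))
               refl X Y (V (suc p) as) (wt p a) (∂V (suc p) as) ⟩
    X * Y * ∂V p (a ∷ as) ∎
    where
    r : ℕ → List ℕ × ℕ
    r i = replaceAt i n as
    p<n : p < n
    p<n = subst (p <_) p+∣aas∣≡n (ℕP.m<m+n p (s≤s z≤n))

  ∑-insertInCycle : ∀ n π → IsPerm n π →
                    ∑< (suc n) (λ i → V 0 (insertInCycle n i π)) ≡ Z * V 0 π + X * Y * ∂V 0 π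
  ∑-insertInCycle n π (length-π , π<n , _) = begin
    ∑< (suc n) (λ i → V 0 (insertInCycle n i π))
      ≡⟨ ∑<-suc n _ ⟩
    ∑< n (λ i → V 0 (insertInCycle n i π)) + V 0 (insertInCycle n n π)
      ≡⟨ cong₂ _+_ (∑<-cong n (λ i _ → insert-after i)) insert-fixed ⟩
    ∑< n replaced + V 0 π * wt n n
      ≡⟨ cong₂ _+_ (trans (cong (λ l → ∑< l replaced) (sym length-π)) (∑-replaceAt n 0 π π<n length-π))
                   (cong (λ t → V 0 π * weight t X Y Z) (positionType-fixedPoint n)) ⟩
    X * Y * ∂V 0 π + V 0 π * Z
      ≡⟨ solve 5 (λ X Y Z v d → X :* Y :* d :+ v :* Z := Z :* v :+ X :* Y :* d) refl X Y Z (V 0 π) (∂V 0 π) ⟩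
    Z * V 0 π + X * Y * ∂V 0 π ∎
    where
    replaced : ℕ → Carrier
    replaced i = V 0 (proj₁ (replaceAt i n π)) * wt n (proj₂ (replaceAt i n π))
    insert-after : ∀ i → V 0 (insertInCycle n i π) ≡ replaced i
    insert-after i = trans (V-∷ʳ 0 (proj₁ (replaceAt i n π)) (proj₂ (replaceAt i n π)))
                           (cong (λ l → V 0 (proj₁ (replaceAt i n π)) * wt l (proj₂ (replaceAt i n π)))
                                 (trans (replaceAt-length i n π) length-π))
    insert-fixed : V 0 (insertInCycle n n π) ≡ V 0 π * wt n n
    insert-fixed = begin
      V 0 (insertInCycle n n π)           ≡⟨ cong (λ l → V 0 (insertInCycle n l π)) (sym length-π) ⟩
      V 0 (insertInCycle n (length π) π)  ≡⟨ cong (λ q → V 0 (proj₁ q ++ [ proj₂ q ])) (replaceAt-length-π n π) ⟩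
      V 0 (π ++ [ n ])                    ≡⟨ V-∷ʳ 0 π n ⟩
      V 0 π * wt (length π) n             ≡⟨ cong (λ l → V 0 π * wt l n) length-π ⟩
      V 0 π * wt n n                      ∎

F : ℕ → Poly₃
F n R X Y Z = Sums.∑ R (Perm n) (ExcedanceWeight.V R X Y Z 0)

F-dual : ∀ n R X Y Z → F n (Dual R) (_+ε {R} X) (_+ε {R} Y) (_+ε {R} Z)
                       ≡ (F n R X Y Z , Sums.∑ R (Perm n) (ExcedanceWeight.∂V R X Y Z 0))
F-dual n R X Y Z = trans (DualProperties.∑-dual R (Perm n) _)
  (cong₂ _,_ (∑-cong (Perm n) (λ π _ → cong proj₁ (ExcedanceWeightDual.V-dual R X Y Z 0 π)))
             (∑-cong (Perm n) (λ π _ → cong proj₂ (ExcedanceWeightDual.V-dual R X Y Z 0 π))))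
  where open Sums R

F-recurrence : Recurrence (λ R X Y Z → Z) F
F-recurrence n R X Y Z = begin
  ∑ (Perm (suc n)) (V 0)
    ≡⟨ ∑-Perm-suc (cycleInsertion n) (V 0) ⟩
  ∑ (Perm n) (λ π → ∑< (suc n) (λ i → V 0 (insertInCycle n i π)))
    ≡⟨ ∑-cong (Perm n) (λ π π∈ → ∑-insertInCycle n π (∈-Perm⁻ n π∈)) ⟩
  ∑ (Perm n) (λ π → Z * V 0 π + X * Y * ∂V 0 π)
    ≡⟨ trans (∑-+ (Perm n) _ _) (cong₂ _+_ (∑-*ˡ (Perm n) Z (V 0)) (∑-*ˡ (Perm n) (X * Y) (∂V 0))) ⟩
  Z * F n R X Y Z + X * Y * ∑ (Perm n) (∂V 0)
    ≡⟨ cong (λ d → Z * F n R X Y Z + X * Y * d) (cong proj₂ (F-dual n R X Y Z)) ⟨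
  Z * F n R X Y Z + X * Y * ∂ (F n) R X Y Z ∎
  where
  open CommRing R
  open Sums R
  open PermSums R
  open CycleInsertionSum R X Y Z
  open ≡-Reasoning

-- The second identity

module BinomialSums (R : CommRing) where
  open CommRing R
  open CommRingProperties R
  open Sums R
  open ≡-Reasoning

  ∑<-binomial-suc : ∀ n (a b : ℕ → Carrier) →
    ∑< (suc (suc n)) (λ i → nat (suc n C i) * (a i * b (suc n ∸ i)))
    ≡ ∑< (suc n) (λ i → nat (n C i) * (a i * b (suc (n ∸ i)) + a (suc i) * b (n ∸ i)))
  ∑<-binomial-suc n a b = begin
    nat 1 * (a 0 * b (suc n)) + ∑< (suc n) (λ i → nat (suc n C suc i) * (a (suc i) * b (n ∸ i)))
      ≡⟨ cong (_+_ (nat 1 * (a 0 * b (suc n))))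
              (trans (∑<-cong (suc n) (λ i _ → pascal i)) (∑<-+ (suc n) A′ B)) ⟩
    nat 1 * (a 0 * b (suc n)) + (∑< (suc n) A′ + ∑< (suc n) B)
      ≡⟨ +-assoc _ _ _ ⟨
    ∑< (suc (suc n)) A + ∑< (suc n) B
      ≡⟨ cong (_+ ∑< (suc n) B)
              (trans (∑<-suc (suc n) A) (trans (cong (_+_ (∑< (suc n) A)) last-zero) (+-identityʳ _))) ⟩
    ∑< (suc n) A + ∑< (suc n) B
      ≡⟨ cong (_+ ∑< (suc n) B) (∑<-cong (suc n) (λ i i<1+n → cong (λ k → nat (n C i) * (a i * b k))
                                                                     (ℕP.+-∸-assoc 1 (ℕP.≤-pred i<1+n)))) ⟩
    ∑< (suc n) A″ + ∑< (suc n) B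
      ≡⟨ ∑<-+ (suc n) A″ B ⟨
    ∑< (suc n) (λ i → A″ i + B i)
      ≡⟨ ∑<-cong (suc n) (λ i _ → sym (distribˡ (nat (n C i)) (a i * b (suc (n ∸ i))) (a (suc i) * b (n ∸ i)))) ⟩
    ∑< (suc n) (λ i → nat (n C i) * (a i * b (suc (n ∸ i)) + a (suc i) * b (n ∸ i))) ∎
    where
    A A′ A″ B : ℕ → Carrier
    A  i = nat (n C i) * (a i * b (suc n ∸ i))
    A′ i = A (suc i)
    A″ i = nat (n C i) * (a i * b (suc (n ∸ i)))
    B  i = nat (n C i) * (a (suc i) * b (n ∸ i))
    pascal : ∀ i → nat (suc n C suc i) * (a (suc i) * b (n ∸ i)) ≡ A′ i + B i
    pascal i = begin
      nat (suc n C suc i) * (a (suc i) * b (n ∸ i))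
        ≡⟨ cong (λ k → nat k * (a (suc i) * b (n ∸ i))) (nCk+nC[k+1]≡[n+1]C[k+1] n i) ⟨
      ι (+ (n C i) ℤ.+ + (n C suc i)) * (a (suc i) * b (n ∸ i))
        ≡⟨ trans (cong (_* (a (suc i) * b (n ∸ i))) (ι-+ _ _)) (distribʳ _ _ _) ⟩
      B i + A′ i
        ≡⟨ +-comm _ _ ⟩
      A′ i + B i ∎
    last-zero : A (suc n) ≡ 0#
    last-zero = trans (cong (λ k → nat k * (a (suc n) * b (n ∸ n))) (k>n⇒nCk≡0 (ℕP.n<1+n n))) (zeroˡ _)

-- True for every polynomial, but not for every ring-polymorphic function.
DualCompatible : Poly₃ → Set₁
DualCompatible f = ∀ R X Y Z → proj₁ (f (Dual R) (_+ε {R} X) (_+ε {R} Y) (_+ε {R} Z)) ≡ f R X Y Z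

_⋆_ : (ℕ → Poly₃) → (ℕ → Poly₃) → ℕ → Poly₃
(f ⋆ g) n R X Y Z = Sums.∑< R (suc n) (λ i → nat (n C i) * (f i R X Y Z * g (n ∸ i) R X Y Z))
  where open CommRing R

-- The Leibniz rule for the derivation XY∂.
⋆-recurrence : ∀ {c d} f g → Recurrence c f → Recurrence d g →
               (∀ n → DualCompatible (f n)) → (∀ n → DualCompatible (g n)) →
               Recurrence (λ R X Y Z → CommRing._+_ R (c R X Y Z) (d R X Y Z)) (f ⋆ g)
⋆-recurrence {c} {d} f g rec-f rec-g f-compatible g-compatible n R X Y Z = begin
  (f ⋆ g) (suc n) R X Y Z
    ≡⟨ ∑<-binomial-suc n fᵢ gᵢ ⟩
  ∑< (suc n) (λ i → nat (n C i) * (fᵢ i * gᵢ (suc (n ∸ i)) + fᵢ (suc i) * gᵢ (n ∸ i)))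
    ≡⟨ ∑<-cong (suc n) (λ i _ → summand i) ⟩
  ∑< (suc n) (λ i → (c′ + d′) * term i + X * Y * ∂summand i)
    ≡⟨ trans (∑<-+ (suc n) (λ i → (c′ + d′) * term i) (λ i → X * Y * ∂summand i))
             (cong₂ _+_ (∑<-*ˡ (suc n) (c′ + d′) term) (∑<-*ˡ (suc n) (X * Y) ∂summand)) ⟩
  (c′ + d′) * (f ⋆ g) n R X Y Z + X * Y * ∑< (suc n) ∂summand
    ≡⟨ cong (λ t → (c′ + d′) * (f ⋆ g) n R X Y Z + X * Y * t) ∂[f⋆g] ⟨
  (c′ + d′) * (f ⋆ g) n R X Y Z + X * Y * ∂ ((f ⋆ g) n) R X Y Z ∎
  where
  open CommRing R
  open CommRingProperties R
  open Sums R
  open BinomialSums R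
  open ≡-Reasoning
  module D = CommRing (Dual R)
  c′ = c R X Y Z
  d′ = d R X Y Z
  fᵢ gᵢ ∂fᵢ ∂gᵢ : ℕ → Carrier
  fᵢ  i = f i R X Y Z
  gᵢ  i = g i R X Y Z
  ∂fᵢ i = ∂ (f i) R X Y Z
  ∂gᵢ i = ∂ (g i) R X Y Z
  term ∂summand : ℕ → Carrier
  term i = nat (n C i) * (fᵢ i * gᵢ (n ∸ i))
  ∂summand i = nat (n C i) * (fᵢ i * ∂gᵢ (n ∸ i) + ∂fᵢ i * gᵢ (n ∸ i)) + 0# * (fᵢ i * gᵢ (n ∸ i))
  summand : ∀ i → nat (n C i) * (fᵢ i * gᵢ (suc (n ∸ i)) + fᵢ (suc i) * gᵢ (n ∸ i))
                  ≡ (c′ + d′) * term i + X * Y * ∂summand i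
  summand i = trans
    (cong₂ (λ p q → nat (n C i) * (fᵢ i * p + q * gᵢ (n ∸ i))) (rec-g (n ∸ i) R X Y Z) (rec-f i R X Y Z))
    (solve 9 (λ N c d X Y a b a′ b′ → N :* (a :* (d :* b :+ X :* Y :* b′) :+ (c :* a :+ X :* Y :* a′) :* b)
                := (c :+ d) :* (N :* (a :* b)) :+ X :* Y :* (N :* (a :* b′ :+ a′ :* b) :+ con (+ 0) :* (a :* b)))
           refl (nat (n C i)) c′ d′ X Y (fᵢ i) (gᵢ (n ∸ i)) (∂fᵢ i) (∂gᵢ (n ∸ i)))
  dualᵢ : (ℕ → Poly₃) → ℕ → Carrier × Carrier
  dualᵢ h k = h k (Dual R) (_+ε {R} X) (_+ε {R} Y) (_+ε {R} Z)
  dual : ∀ (h : ℕ → Poly₃) → (∀ k → DualCompatible (h k)) → ∀ k →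
         h k (Dual R) (_+ε {R} X) (_+ε {R} Y) (_+ε {R} Z) ≡ (h k R X Y Z , ∂ (h k) R X Y Z)
  dual h h-compatible k = cong (_, ∂ (h k) R X Y Z) (h-compatible k R X Y Z)
  ∂[f⋆g] : ∂ ((f ⋆ g) n) R X Y Z ≡ ∑< (suc n) ∂summand
  ∂[f⋆g] = trans
    (cong proj₂ (DualProperties.∑<-dual R (suc n) (λ i → D.ι (+ (n C i)) D.* (dualᵢ f i D.* dualᵢ g (n ∸ i)))))
    (∑<-cong (suc n) (λ i _ → cong (λ p → proj₂ (D.ι (+ (n C i)) D.* p))
                                   (cong₂ D._*_ (dual f f-compatible i) (dual g g-compatible (n ∸ i)))))

F-dualCompatible : ∀ n → DualCompatible (F n)
F-dualCompatible n R X Y Z = cong proj₁ (F-dual n R X Y Z)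

P-at-2Z-Y : ℕ → Poly₃
P-at-2Z-Y n R X Y Z = P n R X Y (Z + Z + - Y)
  where open CommRing R

P-at-2Z-Y-recurrence : Recurrence (λ R X Y Z → CommRing._+_ R Z Z) P-at-2Z-Y
P-at-2Z-Y-recurrence n R X Y Z = begin
  P (suc n) R X Y Z′
    ≡⟨ P-recurrence n R X Y Z′ ⟩
  (Y + Z′) * P n R X Y Z′ + X * Y * ∂ (P n) R X Y Z′
    ≡⟨ cong₂ (λ s t → s * P n R X Y Z′ + X * Y * proj₂ (P n (Dual R) (_+ε {R} X) (_+ε {R} Y) t))
         (solve 2 (λ Y Z → Y :+ (Z :+ Z :+ :- Y) := Z :+ Z) refl Y Z)
         (cong (Z′ ,_) (solve 0 (con (+ 1) := con (+ 1) :+ con (+ 1) :+ :- con (+ 1)) refl)) ⟩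
  (Z + Z) * P-at-2Z-Y n R X Y Z + X * Y * ∂ (P-at-2Z-Y n) R X Y Z ∎
  where
  open CommRing R
  open CommRingProperties R
  open ≡-Reasoning
  Z′ = Z + Z + - Y

F⋆F≡P-at-2Z-Y : ∀ n R X Y Z → (F ⋆ F) n R X Y Z ≡ P-at-2Z-Y n R X Y Z
F⋆F≡P-at-2Z-Y = recurrence-determined (F ⋆ F) P-at-2Z-Y
  (⋆-recurrence F F F-recurrence F-recurrence F-dualCompatible F-dualCompatible) P-at-2Z-Y-recurrence
  (λ R X Y Z → let open CommRingProperties R in
     solve 0 (con (+ 1) :* ((con (+ 1) :+ con (+ 0)) :* (con (+ 1) :+ con (+ 0))) :+ con (+ 0)
              := con (+ 1) :+ con (+ 0)) refl)

whenZero : ℕ → ℤ → ℤ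
whenZero zero    v = v
whenZero (suc _) v = + 0

whenZero-+-* : ∀ i f v w → whenZero (i ℕ.+ f) (v ℤ.* w) ≡ whenZero i v ℤ.* whenZero f w
whenZero-+-* zero    zero    v w = refl
whenZero-+-* zero    (suc f) v w = sym (ℤP.*-zeroʳ v)
whenZero-+-* (suc i) f       v w = refl

weight-ℤ′ : ∀ (x : ℤ) p a → ExcedanceWeight.weight ℤ-ring (positionType p a) x (+ 1) (+ 0)
                           ≡ whenZero [ ⌊ p ℕ.≟ a ⌋ ]₀₁ (x ℤ.^ [ ⌊ p ℕ.<? a ⌋ ]₀₁)
weight-ℤ′ x p a with p ℕ.<? a
... | yes p<a with p ℕ.≟ a
...   | yes refl = ⊥-elim (ℕP.<-irrefl refl p<a)
...   | no  _    = sym (ℤP.*-identityʳ x)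
weight-ℤ′ x p a | no _ with p ℕ.≟ a
...   | yes _ = refl
...   | no  _ = refl

V-ℤ : ∀ (x : ℤ) p π → ExcedanceWeight.V ℤ-ring x (+ 1) (+ 0) p π
      ≡ whenZero (countPos (λ i a → ⌊ i ℕ.≟ a ⌋) p π) (x ℤ.^ countPos (λ i a → ⌊ i ℕ.<? a ⌋) p π)
V-ℤ x p []       = refl
V-ℤ x p (a ∷ as) = begin
  ExcedanceWeight.weight ℤ-ring (positionType p a) x (+ 1) (+ 0)
    ℤ.* ExcedanceWeight.V ℤ-ring x (+ 1) (+ 0) (suc p) as
    ≡⟨ cong₂ ℤ._*_ (weight-ℤ′ x p a) (V-ℤ x (suc p) as) ⟩
  whenZero fixₚ (x ℤ.^ excₚ) ℤ.* whenZero fixes (x ℤ.^ excs)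
    ≡⟨ whenZero-+-* fixₚ fixes (x ℤ.^ excₚ) (x ℤ.^ excs) ⟨
  whenZero (fixₚ ℕ.+ fixes) (x ℤ.^ excₚ ℤ.* x ℤ.^ excs)
    ≡⟨ cong (whenZero (fixₚ ℕ.+ fixes)) (ℤP.^-distribˡ-+-* x excₚ excs) ⟨
  whenZero (fixₚ ℕ.+ fixes) (x ℤ.^ (excₚ ℕ.+ excs)) ∎
  where
  open ≡-Reasoning
  fixₚ  = [ ⌊ p ℕ.≟ a ⌋ ]₀₁
  excₚ  = [ ⌊ p ℕ.<? a ⌋ ]₀₁
  fixes = countPos (λ i a → ⌊ i ℕ.≟ a ⌋) (suc p) as
  excs  = countPos (λ i a → ⌊ i ℕ.<? a ⌋) (suc p) as

d≡F : ∀ i (x : ℤ) → d i x ≡ F i ℤ-ring x (+ 1) (+ 0)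
d≡F i x = begin
  d i x
    ≡⟨ ∑-filter (λ π → fix π ℕ.≟ 0) (Perm i) (λ π → x ℤ.^ exc π) ⟩
  ∑ (Perm i) (λ π → if does (fix π ℕ.≟ 0) then x ℤ.^ exc π else + 0)
    ≡⟨ ∑-cong (Perm i) (λ π _ → trans (if-fix≡0 (fix π)) (sym (V-ℤ x 0 π))) ⟩
  F i ℤ-ring x (+ 1) (+ 0) ∎
  where
  open ≡-Reasoning
  open Sums ℤ-ring
  if-fix≡0 : ∀ f {v} → (if does (f ℕ.≟ 0) then v else + 0) ≡ whenZero f v
  if-fix≡0 zero    = refl
  if-fix≡0 (suc f) = refl

second-identity : ∀ n (x : ℤ) → LHS₂ n x ≡ RHS₂ n x
second-identity n x = begin
  LHS₂ n x
    ≡⟨ ∑-upTo (suc n) (λ i → + (n C i) ℤ.* d i x ℤ.* d (n ∸ i) x) ⟩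
  ∑< (suc n) (λ i → + (n C i) ℤ.* d i x ℤ.* d (n ∸ i) x)
    ≡⟨ ∑<-cong (suc n) (λ i _ → trans (ℤP.*-assoc (+ (n C i)) (d i x) (d (n ∸ i) x))
                                      (cong₂ (λ p q → + (n C i) ℤ.* (p ℤ.* q)) (d≡F i x) (d≡F (n ∸ i) x))) ⟩
  (F ⋆ F) n ℤ-ring x (+ 1) (+ 0)
    ≡⟨ F⋆F≡P-at-2Z-Y n ℤ-ring x (+ 1) (+ 0) ⟩
  P n ℤ-ring x (+ 1) (ℤ.- + 1)
    ≡⟨ ∑-cong (Perm (suc n)) (λ π _ → W-ℤ x (+ 1) (ℤ.- + 1) π) ⟨
  LHS₁ n x (+ 1)
    ≡⟨ first-identity n x (+ 1) ⟩
  RHS₁ n x (+ 1)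
    ≡⟨ ∑-cong (upTo (suc (n / 2))) (λ j _ → cong₂ (λ p q → γ n 0 j ℤ.* p ℤ.^ j ℤ.* q ℤ.^ (n ∸ 2 ℕ.* j))
                                                  (ℤP.*-identityʳ (+ 2 ℤ.* x)) (ℤP.+-comm x (+ 1))) ⟩
  RHS₂ n x ∎
  where
  open ≡-Reasoning
  open Sums ℤ-ring

corollary3p3 : (n : ℕ) →
    ((x y : ℤ) → LHS₁ n x y ≡ RHS₁ n x y) × ((x : ℤ) → LHS₂ n x ≡ RHS₂ n x)
corollary3p3 n = first-identity n , second-identity n
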